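{- Let $n\geq 1$, $N=\binom{n+2}{2}$, and let $\mathcal{H}_n=\{\mathbf{H}_{a,b,c}:(a,b,c)\in V(3,n),\ 0<a,b,c<n\}$, $\mathcal{B}_n=\{\mathbf{X}_i,\mathbf{Y}_i,\mathbf{Z}_i:0\le i\le n\}$, $\mathcal{B}'_n=\{\mathbf{X}_i,\mathbf{Y}_i,\mathbf{Z}_i:0\le i\le n-1\}$. Then the linear spans $\mathbb{R}\mathcal{H}_n$ and $\mathbb{R}\mathcal{B}_n$ are orthogonal complements in $\mathbb{R}^N$ (with respect to the standard inner product). In particular $\dim\mathbb{R}\mathcal{B}_n=\binom{n+2}{2}-\binom{n-1}{2}=3n$, the set $\mathcal{B}'_n$ is a basis of $\mathbb{R}\mathcal{B}_n$, and all linear relations among the vectors $\mathbf{X}_i,\mathbf{Y}_i,\mathbf{Z}_i$ ($0\le i\le n$) are generated by the relations $\sum_{i=0}^n\mathbf{X}_i=\sum_{i=0}^n\mathbf{Y}_i=\sum_{i=0}^n\mathbf{Z}_i$ and $n\sum_{i=0}^n\mathbf{X}_i=\sum_{i=0}^n i(\mathbf{X}_i+\mathbf{Y}_i+\mathbf{Z}_i)$.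
   Context: $V(3,n)=\{(i,j,k)\in\mathbb{Z}_{\ge 0}^3: i+j+k=n\}$ and $\mathbb{R}^N$ has standard orthonormal basis $\{\mathbf{e}_{ijk}:(i,j,k)\in V(3,n)\}$. For $0\le i\le n$: $\mathbf{X}_i=\sum_{j+k=n-i}\mathbf{e}_{ijk}$, $\mathbf{Y}_i=\sum_{a+k=n-i}\mathbf{e}_{aik}$, $\mathbf{Z}_i=\sum_{a+b=n-i}\mathbf{e}_{abi}$. For $(a,b,c)\in V(3,n)$ with $a,b,c>0$, $\mathbf{H}_{a,b,c}=\mathbf{e}_{a-1,b,c+1}-\mathbf{e}_{a,b-1,c+1}+\mathbf{e}_{a+1,b-1,c}-\mathbf{e}_{a+1,b,c-1}+\mathbf{e}_{a,b+1,c-1}-\mathbf{e}_{a-1,b+1,c}$.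
   Formalization: Scalars are rational rather than real: the vectors of $\mathbb{R}^N$ have rational entries, and spans, linear independence and the coefficients of linear relations are taken over ℚ. -}

module Defs where

open import Data.Nat as ℕ using (ℕ; zero; suc; _∸_; _<_; _<?_)
open import Data.Nat.Properties using (_≟_)
open import Data.Integer using (+_)
open import Data.Rational using (ℚ; 0ℚ; 1ℚ; _+_; _*_; _-_; -_; _/_)
open import Data.Fin using (Fin; zero; suc)
open import Data.List using (List; []; _∷_; map; concatMap; upTo; filter; length; lookup; _++_)
open import Data.Product using (_×_; _,_; ∃)
open import Data.Bool using (if_then_else_)
open import Relation.Nullary using (does)
open import Relation.Nullary.Decidable using (_×-dec_)
open import Relation.Binary.PropositionalEquality using (_≡_)

⟦_⟧ : ℕ → ℚ
⟦ m ⟧ = + m / 1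

-- A vector of ℝ^N (here with rational entries) is given by its coordinates
-- v i j k at the points (i,j,k) of V(3,n); values off V(3,n) are irrelevant,
-- since every statement below only inspects coordinates on V(3,n).
Vect : Set
Vect = ℕ → ℕ → ℕ → ℚ

Σ≤ : ℕ → (ℕ → ℚ) → ℚ
Σ≤ zero    f = f zero
Σ≤ (suc m) f = Σ≤ m f + f (suc m)

ΣFin : (m : ℕ) → (Fin m → ℚ) → ℚ
ΣFin zero    f = 0ℚ
ΣFin (suc m) f = f zero + ΣFin m (λ l → f (suc l))

ΣList : {A : Set} → List A → (A → ℚ) → ℚ
ΣList []       f = 0ℚ
ΣList (x ∷ xs) f = f x + ΣList xs f

V3 : ℕ → List (ℕ × ℕ × ℕ)
V3 n = concatMap (λ i → map (λ j → (i , j , n ∸ i ∸ j)) (upTo (suc (n ∸ i)))) (upTo (suc n))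

_⊕_ : Vect → Vect → Vect
(u ⊕ v) a b c = u a b c + v a b c

_⊖_ : Vect → Vect → Vect
(u ⊖ v) a b c = u a b c - v a b c

δ : ℕ → ℕ → ℚ
δ x y = if does (x ≟ y) then 1ℚ else 0ℚ

e : ℕ → ℕ → ℕ → Vect
e i j k a b c = δ a i * δ b j * δ c k

X : ℕ → ℕ → Vect
X n i a b c = Σ≤ (n ∸ i) (λ j → e i j (n ∸ i ∸ j) a b c)

Y : ℕ → ℕ → Vect
Y n i a b c = Σ≤ (n ∸ i) (λ a' → e a' i (n ∸ i ∸ a') a b c)

Z : ℕ → ℕ → Vect
Z n i a b c = Σ≤ (n ∸ i) (λ a' → e a' (n ∸ i ∸ a') i a b c)

-- H_{a,b,c} (used only for a,b,c > 0)
H : ℕ → ℕ → ℕ → Vect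
H a b c =
  ((((e (a ∸ 1) b (suc c) ⊖ e a (b ∸ 1) (suc c)) ⊕ e (suc a) (b ∸ 1) c)
     ⊖ e (suc a) b (c ∸ 1)) ⊕ e a (suc b) (c ∸ 1)) ⊖ e (a ∸ 1) (suc b) c

dot : ℕ → Vect → Vect → ℚ
dot n u v = ΣList (V3 n) (λ { (i , j , k) → u i j k * v i j k })

Inner : ℕ → ℕ × ℕ × ℕ → Set
Inner n (a , b , c) = ((0 < a) × (a < n)) × ((0 < b) × (b < n)) × ((0 < c) × (c < n))

inner? : (n : ℕ) → (t : ℕ × ℕ × ℕ) → Relation.Nullary.Dec (Inner n t)
inner? n (a , b , c) =
  ((0 <? a) ×-dec (a <? n)) ×-dec (((0 <? b) ×-dec (b <? n)) ×-dec ((0 <? c) ×-dec (c <? n)))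

Hs : ℕ → List Vect
Hs n = map (λ { (a , b , c) → H a b c }) (filter (inner? n) (V3 n))

Bs : ℕ → List Vect
Bs n = map (X n) (upTo (suc n)) ++ map (Y n) (upTo (suc n)) ++ map (Z n) (upTo (suc n))

B's : ℕ → List Vect
B's n = map (X n) (upTo n) ++ map (Y n) (upTo n) ++ map (Z n) (upTo n)

_≈[_]_ : Vect → ℕ → Vect → Set
u ≈[ n ] v = ∀ i j k → i ℕ.+ j ℕ.+ k ≡ n → u i j k ≡ v i j k

lincomb : (L : List Vect) → (Fin (length L) → ℚ) → Vect
lincomb L c a b d = ΣFin (length L) (λ l → c l * lookup L l a b d)

InSpan : ℕ → List Vect → Vect → Set
InSpan n L v = ∃ λ (c : Fin (length L) → ℚ) → v ≈[ n ] lincomb L c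

LinIndep : ℕ → List Vect → Set
LinIndep n L = ∀ (c : Fin (length L) → ℚ) → lincomb L c ≈[ n ] (λ _ _ _ → 0ℚ) → ∀ l → c l ≡ 0ℚ

relVec : ℕ → (ℕ → ℚ) → (ℕ → ℚ) → (ℕ → ℚ) → Vect
relVec n x y z a b c = Σ≤ n (λ i → x i * X n i a b c + y i * Y n i a b c + z i * Z n i a b c)

-- Pairing with H_{a,b,c} takes the alternating sum of a vector around a hexagon of V(3,n), and
-- this sum vanishes on the "separable" vectors v(a,b,c) = x a + y b + z c, which are exactly the
-- span of the X_i, Y_i, Z_i.  Conversely, a vector with vanishing hexagon sums is determined by
-- its values on the frame {c ≤ 1} ∪ {a = 0}, and every function on the frame has a separable
-- extension; hence 𝓗_n^⊥ = ℝ𝓑_n.  For 𝓑_n^⊥ ⊆ ℝ𝓗_n, each point off the frame is the pivot of one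
-- hexagon, so Gaussian elimination turns v ⊥ 𝓑_n into a vector r ⊥ 𝓑_n supported on the frame;
-- with e the separable extension of r restricted to the frame, ⟨r, r⟩ = ⟨r, e⟩ = 0.
-- A relation Σ x_i X_i + y_i Y_i + z_i Z_i = 0 means x a + y b + z c = 0 on V(3,n); comparing
-- neighbouring points shows that y and z are arithmetic progressions with a common difference,
-- which yields the three generating relations, and using them to make the coefficients of
-- X_n, Y_n, Z_n vanish shows that 𝓑'_n is a basis.

module Submission where

open import Defs
open import Data.Nat as ℕ using (ℕ; zero; suc; z≤n; s≤s; _≤_; _<_; _∸_)
import Data.Nat.Properties as ℕP
import Data.Nat.Solver as ℕSolver
open import Data.Fin using (Fin; zero; suc)
open import Data.List using (List; []; _∷_; map; concatMap; applyUpTo; upTo; filter; length; _++_)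
import Data.List.Properties as ListP
open import Data.List.Relation.Unary.All using (All; []; _∷_)
import Data.List.Relation.Unary.All as All using (zipWith; map)
import Data.List.Relation.Unary.All.Properties as AllP
open import Data.Product using (_×_; _,_; proj₁; proj₂; ∃)
import Data.Product
open import Data.Sum using (_⊎_; inj₁; inj₂)
open import Function.Bundles using (_⇔_; mk⇔; Equivalence)
open import Data.Empty using (⊥-elim)
open import Relation.Nullary using (Dec; yes; no)
open import Relation.Unary using (Decidable)
open import Relation.Binary.PropositionalEquality
open import Function using (_∘_)

Triple : Set
Triple = ℕ × ℕ × ℕ

descend : ∀ {P : ℕ → Set} N → P N → (∀ k → P (suc k) → P k) → P 0
descend zero    p₀ step = p₀
descend (suc N) pₙ step = descend N (step N pₙ) step

filter-All⁺ : ∀ {A : Set} {P Q : A → Set} (P? : Decidable P) (L : List A) → All (λ x → P x → Q x) L → All Q (filter P? L)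
filter-All⁺ P? []      []         = []
filter-All⁺ P? (x ∷ L) (Qx ∷ QL) with P? x
... | yes Px = Qx Px ∷ filter-All⁺ P? L QL
... | no  _  = filter-All⁺ P? L QL

filter-All⁻ : ∀ {A : Set} {P Q : A → Set} (P? : Decidable P) (L : List A) → All Q (filter P? L) → All (λ x → P x → Q x) L
filter-All⁻ P? []      _ = []
filter-All⁻ P? (x ∷ L) QL with P? x
filter-All⁻ P? (x ∷ L) (Qx ∷ QL) | yes _  = (λ _ → Qx) ∷ filter-All⁻ P? L QL
filter-All⁻ P? (x ∷ L) QL        | no ¬Px = (λ Px → ⊥-elim (¬Px Px)) ∷ filter-All⁻ P? L QL

module RationalFacts where
  open import Data.Rational using (ℚ; 0ℚ; 1ℚ; _+_; _*_; _-_; mkℚ; toℚᵘ; 1/_; NonZero; ≢-nonZero; _≟_)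
  import Data.Rational as ℚ
  import Data.Rational.Properties as ℚP
  import Data.Rational.Unnormalised as ℚᵘ
  import Data.Rational.Unnormalised.Properties as ℚᵘP
  open import Data.Integer using (+_; -[1+_])
  import Data.Integer as ℤ
  import Data.Integer.Properties as ℤP
  open import Data.Nat.Divisibility using (∣1⇒≡1)
  open import Data.Nat.Coprimality using (Coprime)
  open import Data.Rational.Solver using (module +-*-Solver)
  open +-*-Solver using (solve; _:+_; _:*_; _:=_; con)
  open import Algebra.Properties.Group ℚP.+-0-group public using () renaming (x∙y⁻¹≈ε⇒x≈y to x-y≡0⇒x≡y)
  open ≡-Reasoning

  coprime-1 : ∀ m → Coprime m 1
  coprime-1 m (_ , d∣1) = ∣1⇒≡1 d∣1

  ⟦⟧≡mkℚ : ∀ m → ⟦ m ⟧ ≡ mkℚ (+ m) 0 (coprime-1 m)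
  ⟦⟧≡mkℚ m = ℚP.normalize-coprime (coprime-1 m)

  ⟦⟧-homo-+ : ∀ a b → ⟦ a ℕ.+ b ⟧ ≡ ⟦ a ⟧ + ⟦ b ⟧
  ⟦⟧-homo-+ a b = ℚP.toℚᵘ-injective (ℚᵘP.≃-trans same-numerators (ℚᵘP.≃-sym (ℚP.toℚᵘ-homo-+ ⟦ a ⟧ ⟦ b ⟧)))
    where
    same-numerators : toℚᵘ ⟦ a ℕ.+ b ⟧ ℚᵘ.≃ (toℚᵘ ⟦ a ⟧ ℚᵘ.+ toℚᵘ ⟦ b ⟧)
    same-numerators rewrite ⟦⟧≡mkℚ a | ⟦⟧≡mkℚ b | ⟦⟧≡mkℚ (a ℕ.+ b) =
      ℚᵘ.*≡* (begin
        + (a ℕ.+ b) ℤ.* + 1             ≡⟨ ℤP.*-identityʳ _ ⟩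
        + (a ℕ.+ b)                     ≡⟨ ℤP.pos-+ a b ⟩
        + a ℤ.+ + b                     ≡⟨ sym (cong₂ ℤ._+_ (ℤP.*-identityʳ (+ a)) (ℤP.*-identityʳ (+ b))) ⟩
        + a ℤ.* + 1 ℤ.+ + b ℤ.* + 1     ≡⟨ sym (ℤP.*-identityʳ _) ⟩
        (+ a ℤ.* + 1 ℤ.+ + b ℤ.* + 1) ℤ.* + 1 ∎)

  x*y≡0⇒x≡0 : ∀ x y .{{_ : NonZero y}} → x * y ≡ 0ℚ → x ≡ 0ℚ
  x*y≡0⇒x≡0 x y xy≡0 = begin
    x              ≡⟨ sym (ℚP.*-identityʳ x) ⟩
    x * 1ℚ         ≡⟨ cong (x *_) (sym (ℚP.*-inverseʳ y)) ⟩
    x * (y * 1/ y) ≡⟨ sym (ℚP.*-assoc x y (1/ y)) ⟩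
    x * y * 1/ y   ≡⟨ cong (_* 1/ y) xy≡0 ⟩
    0ℚ * 1/ y      ≡⟨ ℚP.*-zeroˡ (1/ y) ⟩
    0ℚ             ∎

  x*⟦suc⟧≡0⇒x≡0 : ∀ x m → x * ⟦ suc m ⟧ ≡ 0ℚ → x ≡ 0ℚ
  x*⟦suc⟧≡0⇒x≡0 x m rewrite ⟦⟧≡mkℚ (suc m) = x*y≡0⇒x≡0 x _

  ½ : ℚ
  ½ = + 1 ℚ./ 2

  ½*x+½*x≡x : ∀ x → ½ * x + ½ * x ≡ x
  ½*x+½*x≡x = solve 1 (λ x → con ½ :* x :+ con ½ :* x := x) refl

  x+x≡0⇒x≡0 : ∀ x → x + x ≡ 0ℚ → x ≡ 0ℚ
  x+x≡0⇒x≡0 x x+x≡0 = begin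
    x            ≡⟨ sym (trans (ℚP.*-distribˡ-+ ½ x x) (½*x+½*x≡x x)) ⟩
    ½ * (x + x)  ≡⟨ cong (½ *_) x+x≡0 ⟩
    ½ * 0ℚ       ≡⟨ ℚP.*-zeroʳ ½ ⟩
    0ℚ           ∎

  ∃-*⟦suc⟧≡ : ∀ x m → ∃ λ y → y * ⟦ suc m ⟧ ≡ x
  ∃-*⟦suc⟧≡ x m rewrite ⟦⟧≡mkℚ (suc m) = x * 1/ q , (begin
    x * 1/ q * q    ≡⟨ ℚP.*-assoc x (1/ q) q ⟩
    x * (1/ q * q)  ≡⟨ cong (x *_) (ℚP.*-inverseˡ q) ⟩
    x * 1ℚ          ≡⟨ ℚP.*-identityʳ x ⟩
    x               ∎)
    where
    q : ℚ
    q = mkℚ (+ suc m) 0 (coprime-1 (suc m))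

  x*x≡0⇒x≡0 : ∀ x → x * x ≡ 0ℚ → x ≡ 0ℚ
  x*x≡0⇒x≡0 x xx≡0 with x ≟ 0ℚ
  ... | yes x≡0 = x≡0
  ... | no x≢0 = x*y≡0⇒x≡0 x x {{≢-nonZero x≢0}} xx≡0

  x*x≥0 : ∀ x → 0ℚ ℚ.≤ x * x
  x*x≥0 x@(mkℚ (+ _) _ _)    = ℚP.nonNegative⁻¹ (x * x) {{ℚP.nonNeg*nonNeg⇒nonNeg x x}}
  x*x≥0 x@(mkℚ -[1+ _ ] _ _) = ℚP.nonNegative⁻¹ (x * x) {{ℚP.nonPos*nonPos⇒nonPos x x}}

  x≥0∧y≥0∧x+y≡0⇒x≡0 : ∀ x y → 0ℚ ℚ.≤ x → 0ℚ ℚ.≤ y → x + y ≡ 0ℚ → x ≡ 0ℚ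
  x≥0∧y≥0∧x+y≡0⇒x≡0 x y 0≤x 0≤y x+y≡0 = ℚP.≤-antisym x≤0 0≤x
    where
    x≤0 : x ℚ.≤ 0ℚ
    x≤0 = subst₂ ℚ._≤_ (ℚP.+-identityʳ x) x+y≡0 (ℚP.+-monoʳ-≤ x 0≤y)

  δ-refl : ∀ x → δ x x ≡ 1ℚ
  δ-refl zero    = refl
  δ-refl (suc x) = δ-refl x

  δ-≢ : ∀ {x y} → x ≢ y → δ x y ≡ 0ℚ
  δ-≢ {zero}  {zero}  x≢y = ⊥-elim (x≢y refl)
  δ-≢ {zero}  {suc y} x≢y = refl
  δ-≢ {suc x} {zero}  x≢y = refl
  δ-≢ {suc x} {suc y} x≢y = δ-≢ (x≢y ∘ cong suc)

  δ-comm : ∀ x y → δ x y ≡ δ y x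
  δ-comm zero    zero    = refl
  δ-comm zero    (suc y) = refl
  δ-comm (suc x) zero    = refl
  δ-comm (suc x) (suc y) = δ-comm x y

  δ*-absorb : ∀ x y s → (x ≡ y → s ≡ 1ℚ) → δ x y * s ≡ δ x y
  δ*-absorb x y s h with x ℕP.≟ y
  ... | yes refl = trans (cong (δ x x *_) (h refl)) (ℚP.*-identityʳ _)
  ... | no x≢y  = trans (cong (_* s) (δ-≢ x≢y)) (trans (ℚP.*-zeroˡ s) (sym (δ-≢ x≢y)))

module Sums where
  open import Data.Rational using (ℚ; 0ℚ; 1ℚ; _+_; _*_; _-_)
  import Data.Rational as ℚ
  import Data.Rational.Properties as ℚP
  open import Data.Rational.Solver using (module +-*-Solver)
  open +-*-Solver using (solve; _:+_; _:-_; _:=_)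
  open RationalFacts

  Σ< : ℕ → (ℕ → ℚ) → ℚ
  Σ< zero    f = 0ℚ
  Σ< (suc m) f = f 0 + Σ< m (f ∘ suc)

  Σ<-cong : ∀ m {f g : ℕ → ℚ} → (∀ i → i < m → f i ≡ g i) → Σ< m f ≡ Σ< m g
  Σ<-cong zero    f≡g = refl
  Σ<-cong (suc m) f≡g = cong₂ _+_ (f≡g 0 (s≤s z≤n)) (Σ<-cong m (λ i i<m → f≡g (suc i) (s≤s i<m)))

  Σ<-zero : ∀ m (f : ℕ → ℚ) → (∀ i → i < m → f i ≡ 0ℚ) → Σ< m f ≡ 0ℚ
  Σ<-zero zero    f f≡0 = refl
  Σ<-zero (suc m) f f≡0 = cong₂ _+_ (f≡0 0 (s≤s z≤n)) (Σ<-zero m (f ∘ suc) (λ i i<m → f≡0 (suc i) (s≤s i<m)))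

  Σ<-+ : ∀ m (f g : ℕ → ℚ) → Σ< m (λ i → f i + g i) ≡ Σ< m f + Σ< m g
  Σ<-+ zero    f g = refl
  Σ<-+ (suc m) f g = trans (cong (f 0 + g 0 +_) (Σ<-+ m (f ∘ suc) (g ∘ suc)))
    (solve 4 (λ a b c d → (a :+ b) :+ (c :+ d) := (a :+ c) :+ (b :+ d)) refl (f 0) (g 0) _ _)

  Σ<-*ˡ : ∀ m c (f : ℕ → ℚ) → Σ< m (λ i → c * f i) ≡ c * Σ< m f
  Σ<-*ˡ zero    c f = sym (ℚP.*-zeroʳ c)
  Σ<-*ˡ (suc m) c f = trans (cong (c * f 0 +_) (Σ<-*ˡ m c (f ∘ suc))) (sym (ℚP.*-distribˡ-+ c (f 0) _))

  Σ<-snoc : ∀ m (f : ℕ → ℚ) → Σ< (suc m) f ≡ Σ< m f + f m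
  Σ<-snoc zero    f = trans (ℚP.+-identityʳ (f 0)) (sym (ℚP.+-identityˡ (f 0)))
  Σ<-snoc (suc m) f = trans (cong (f 0 +_) (Σ<-snoc m (f ∘ suc))) (sym (ℚP.+-assoc (f 0) _ _))

  Σ≤≡Σ< : ∀ m f → Σ≤ m f ≡ Σ< (suc m) f
  Σ≤≡Σ< zero    f = sym (ℚP.+-identityʳ (f 0))
  Σ≤≡Σ< (suc m) f = trans (cong (_+ f (suc m)) (Σ≤≡Σ< m f)) (sym (Σ<-snoc (suc m) f))

  Σ<-δ : ∀ m a (g : ℕ → ℚ) → a < m → Σ< m (λ i → δ i a * g i) ≡ g a
  Σ<-δ (suc m) zero    g _ = begin
    1ℚ * g 0 + Σ< m (λ i → 0ℚ * g (suc i)) ≡⟨ cong₂ _+_ (ℚP.*-identityˡ (g 0)) (Σ<-zero m _ (λ i _ → ℚP.*-zeroˡ (g (suc i)))) ⟩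
    g 0 + 0ℚ                                ≡⟨ ℚP.+-identityʳ (g 0) ⟩
    g 0                                     ∎
    where open ≡-Reasoning
  Σ<-δ (suc m) (suc a) g (s≤s a<m) =
    trans (cong₂ _+_ (ℚP.*-zeroˡ (g 0)) (Σ<-δ m a (g ∘ suc) a<m)) (ℚP.+-identityˡ _)

  Σ<-δ-outside : ∀ m a (g : ℕ → ℚ) → m ≤ a → Σ< m (λ i → δ i a * g i) ≡ 0ℚ
  Σ<-δ-outside zero    a       g _         = refl
  Σ<-δ-outside (suc m) (suc a) g (s≤s m≤a) = cong₂ _+_ (ℚP.*-zeroˡ (g 0)) (Σ<-δ-outside m a (g ∘ suc) m≤a)

  Σ≤-cong : ∀ m {f g : ℕ → ℚ} → (∀ i → f i ≡ g i) → Σ≤ m f ≡ Σ≤ m g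
  Σ≤-cong zero    f≡g = f≡g 0
  Σ≤-cong (suc m) f≡g = cong₂ _+_ (Σ≤-cong m f≡g) (f≡g (suc m))

  Σ≤-*ˡ : ∀ m c (f : ℕ → ℚ) → Σ≤ m (λ i → c * f i) ≡ c * Σ≤ m f
  Σ≤-*ˡ zero    c f = refl
  Σ≤-*ˡ (suc m) c f = trans (cong (_+ c * f (suc m)) (Σ≤-*ˡ m c f)) (sym (ℚP.*-distribˡ-+ c _ _))

  ΣList-cong : ∀ {A : Set} (L : List A) {f g : A → ℚ} → (∀ x → f x ≡ g x) → ΣList L f ≡ ΣList L g
  ΣList-cong []      f≡g = refl
  ΣList-cong (x ∷ L) f≡g = cong₂ _+_ (f≡g x) (ΣList-cong L f≡g)

  ΣList-zero : ∀ {A : Set} (L : List A) (f : A → ℚ) → (∀ x → f x ≡ 0ℚ) → ΣList L f ≡ 0ℚ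
  ΣList-zero []      f f≡0 = refl
  ΣList-zero (x ∷ L) f f≡0 = cong₂ _+_ (f≡0 x) (ΣList-zero L f f≡0)

  ΣList-+ : ∀ {A : Set} (L : List A) (f g : A → ℚ) → ΣList L (λ x → f x + g x) ≡ ΣList L f + ΣList L g
  ΣList-+ []      f g = refl
  ΣList-+ (x ∷ L) f g = trans (cong (f x + g x +_) (ΣList-+ L f g))
    (solve 4 (λ a b c d → (a :+ b) :+ (c :+ d) := (a :+ c) :+ (b :+ d)) refl (f x) (g x) _ _)

  ΣList-- : ∀ {A : Set} (L : List A) (f g : A → ℚ) → ΣList L (λ x → f x - g x) ≡ ΣList L f - ΣList L g
  ΣList-- []      f g = refl
  ΣList-- (x ∷ L) f g = trans (cong (f x - g x +_) (ΣList-- L f g))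
    (solve 4 (λ a b c d → (a :- b) :+ (c :- d) := (a :+ c) :- (b :+ d)) refl (f x) (g x) _ _)

  ΣList-*ˡ : ∀ {A : Set} (L : List A) c (f : A → ℚ) → ΣList L (λ x → c * f x) ≡ c * ΣList L f
  ΣList-*ˡ []      c f = sym (ℚP.*-zeroʳ c)
  ΣList-*ˡ (x ∷ L) c f = trans (cong (c * f x +_) (ΣList-*ˡ L c f)) (sym (ℚP.*-distribˡ-+ c (f x) _))

  ΣList-map : ∀ {A B : Set} (h : A → B) (L : List A) (f : B → ℚ) → ΣList (map h L) f ≡ ΣList L (f ∘ h)
  ΣList-map h []      f = refl
  ΣList-map h (x ∷ L) f = cong (f (h x) +_) (ΣList-map h L f)

  ΣList-++ : ∀ {A : Set} (L M : List A) (f : A → ℚ) → ΣList (L ++ M) f ≡ ΣList L f + ΣList M f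
  ΣList-++ []      M f = sym (ℚP.+-identityˡ _)
  ΣList-++ (x ∷ L) M f = trans (cong (f x +_) (ΣList-++ L M f)) (sym (ℚP.+-assoc (f x) _ _))

  ΣList-concatMap : ∀ {A B : Set} (g : A → List B) (L : List A) (f : B → ℚ) →
                    ΣList (concatMap g L) f ≡ ΣList L (λ x → ΣList (g x) f)
  ΣList-concatMap g []      f = refl
  ΣList-concatMap g (x ∷ L) f = trans (ΣList-++ (g x) (concatMap g L) f) (cong (ΣList (g x) f +_) (ΣList-concatMap g L f))

  ΣList-applyUpTo : ∀ (h : ℕ → ℕ) m (f : ℕ → ℚ) → ΣList (applyUpTo h m) f ≡ Σ< m (f ∘ h)
  ΣList-applyUpTo h zero    f = refl
  ΣList-applyUpTo h (suc m) f = cong (f (h 0) +_) (ΣList-applyUpTo (h ∘ suc) m f)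

  𝟙 : ∀ {P : Set} → Dec P → ℚ
  𝟙 (yes _) = 1ℚ
  𝟙 (no _)  = 0ℚ

  𝟙-yes : ∀ {P : Set} (P? : Dec P) → P → 𝟙 P? ≡ 1ℚ
  𝟙-yes (yes _) _  = refl
  𝟙-yes (no ¬p) p = ⊥-elim (¬p p)

  ΣList-filter : ∀ {A : Set} {P : A → Set} (P? : Decidable P) (L : List A) (g : A → ℚ) →
                 ΣList (filter P? L) g ≡ ΣList L (λ x → 𝟙 (P? x) * g x)
  ΣList-filter P? []      g = refl
  ΣList-filter P? (x ∷ L) g with P? x
  ... | yes _ = cong₂ _+_ (sym (ℚP.*-identityˡ (g x))) (ΣList-filter P? L g)
  ... | no _  = trans (ΣList-filter P? L g) (sym (trans (cong (_+ _) (ℚP.*-zeroˡ (g x))) (ℚP.+-identityˡ _)))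

  ΣList-squares≥0 : ∀ {A : Set} (L : List A) (f : A → ℚ) → 0ℚ ℚ.≤ ΣList L (λ x → f x * f x)
  ΣList-squares≥0 []      f = ℚP.≤-refl
  ΣList-squares≥0 (x ∷ L) f = ℚP.+-mono-≤ (x*x≥0 (f x)) (ΣList-squares≥0 L f)

  ΣList-squares≡0 : ∀ {A : Set} (L : List A) (f : A → ℚ) → ΣList L (λ x → f x * f x) ≡ 0ℚ → All (λ x → f x ≡ 0ℚ) L
  ΣList-squares≡0 []      f _   = []
  ΣList-squares≡0 (x ∷ L) f Σ≡0 = x*x≡0⇒x≡0 (f x) fx²≡0 ∷ ΣList-squares≡0 L f rest≡0
    where
    fx²≡0 : f x * f x ≡ 0ℚ
    fx²≡0 = x≥0∧y≥0∧x+y≡0⇒x≡0 _ _ (x*x≥0 (f x)) (ΣList-squares≥0 L f) Σ≡0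
    rest≡0 : ΣList L (λ x → f x * f x) ≡ 0ℚ
    rest≡0 = trans (sym (ℚP.+-identityˡ _)) (trans (cong (_+ _) (sym fx²≡0)) Σ≡0)

module Simplex where
  open import Data.Rational using (ℚ; _+_; _*_)
  import Data.Rational.Properties as ℚP
  open import Data.Rational.Solver using (module +-*-Solver)
  open +-*-Solver using (solve; _:*_; _:=_)
  open RationalFacts
  open Sums
  open ≡-Reasoning

  n∸a≡b+c : ∀ a b c {n} → a ℕ.+ b ℕ.+ c ≡ n → n ∸ a ≡ b ℕ.+ c
  n∸a≡b+c a b c refl = trans (cong (_∸ a) (ℕP.+-assoc a b c)) (ℕP.m+n∸m≡n a (b ℕ.+ c))

  n∸b≡a+c : ∀ a b c {n} → a ℕ.+ b ℕ.+ c ≡ n → n ∸ b ≡ a ℕ.+ c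
  n∸b≡a+c a b c eq = n∸a≡b+c b a c (trans (cong (ℕ._+ c) (ℕP.+-comm b a)) eq)

  n∸c≡a+b : ∀ a b c {n} → a ℕ.+ b ℕ.+ c ≡ n → n ∸ c ≡ a ℕ.+ b
  n∸c≡a+b a b c eq = n∸a≡b+c c a b (trans (ℕP.+-assoc c a b) (trans (ℕP.+-comm c (a ℕ.+ b)) eq))

  V3-coordinates : ∀ a b c {n} → a ℕ.+ b ℕ.+ c ≡ n → b ≤ n ∸ a × n ∸ a ∸ b ≡ c
  V3-coordinates a b c eq =
    subst (λ m → b ≤ m × m ∸ b ≡ c) (sym (n∸a≡b+c a b c eq)) (ℕP.m≤m+n b c , ℕP.m+n∸m≡n b c)

  V3-point : ∀ a b {n} → a ≤ n → b ≤ n ∸ a → a ℕ.+ b ℕ.+ (n ∸ a ∸ b) ≡ n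
  V3-point a b a≤n b≤ = trans (ℕP.+-assoc a b _) (trans (cong (a ℕ.+_) (ℕP.m+[n∸m]≡n b≤)) (ℕP.m+[n∸m]≡n a≤n))

  V3-bounds : ∀ a b c {n} → a ℕ.+ b ℕ.+ c ≡ n → a ≤ n × b ≤ n × c ≤ n
  V3-bounds a b c refl =
    ℕP.≤-trans (ℕP.m≤m+n a b) (ℕP.m≤m+n (a ℕ.+ b) c) ,
    ℕP.≤-trans (ℕP.m≤n+m b a) (ℕP.m≤m+n (a ℕ.+ b) c) ,
    ℕP.m≤n+m c (a ℕ.+ b)

  ΣV3 : ∀ n (f : Triple → ℚ) →
        ΣList (V3 n) f ≡ Σ< (suc n) (λ a → Σ< (suc (n ∸ a)) (λ b → f (a , b , n ∸ a ∸ b)))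
  ΣV3 n f = begin
    ΣList (V3 n) f                                 ≡⟨ ΣList-concatMap row (upTo (suc n)) f ⟩
    ΣList (upTo (suc n)) (λ a → ΣList (row a) f)   ≡⟨ ΣList-applyUpTo (λ i → i) (suc n) (λ a → ΣList (row a) f) ⟩
    Σ< (suc n) (λ a → ΣList (row a) f)             ≡⟨ Σ<-cong (suc n) (λ a _ → row-sum a) ⟩
    Σ< (suc n) (λ a → Σ< (suc (n ∸ a)) (λ b → f (a , b , n ∸ a ∸ b))) ∎
    where
    row : ℕ → List Triple
    row a = map (λ b → (a , b , n ∸ a ∸ b)) (upTo (suc (n ∸ a)))
    row-sum : ∀ a → ΣList (row a) f ≡ Σ< (suc (n ∸ a)) (λ b → f (a , b , n ∸ a ∸ b))
    row-sum a = trans (ΣList-map _ (upTo (suc (n ∸ a))) f) (ΣList-applyUpTo (λ i → i) (suc (n ∸ a)) (λ b → f (a , b , n ∸ a ∸ b)))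

  ΣV3-cong : ∀ n (f g : Triple → ℚ) → (∀ a b c → a ℕ.+ b ℕ.+ c ≡ n → f (a , b , c) ≡ g (a , b , c)) →
             ΣList (V3 n) f ≡ ΣList (V3 n) g
  ΣV3-cong n f g f≡g = begin
    ΣList (V3 n) f ≡⟨ ΣV3 n f ⟩
    _              ≡⟨ Σ<-cong (suc n) (λ a a≤n → Σ<-cong (suc (n ∸ a)) (λ b b≤ →
                        f≡g a b _ (V3-point a b (ℕP.≤-pred a≤n) (ℕP.≤-pred b≤)))) ⟩
    _              ≡⟨ sym (ΣV3 n g) ⟩
    ΣList (V3 n) g ∎

  ΣV3-δ : ∀ n i j k (F : Triple → ℚ) → i ℕ.+ j ℕ.+ k ≡ n →
          ΣList (V3 n) (λ { (a , b , c) → F (a , b , c) * e i j k a b c }) ≡ F (i , j , k)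
  ΣV3-δ n i j k F eq = begin
    ΣList (V3 n) summand ≡⟨ ΣV3 n summand ⟩
    Σ< (suc n) (λ a → Σ< (suc (n ∸ a)) (λ b → F (a , b , n ∸ a ∸ b) * (δ a i * δ b j * δ (n ∸ a ∸ b) k)))
      ≡⟨ Σ<-cong (suc n) (λ a _ → trans (Σ<-cong (suc (n ∸ a)) (λ b _ → regroup a b)) (Σ<-*ˡ (suc (n ∸ a)) (δ a i) (G a))) ⟩
    Σ< (suc n) (λ a → δ a i * Σ< (suc (n ∸ a)) (G a))
      ≡⟨ Σ<-δ (suc n) i (λ a → Σ< (suc (n ∸ a)) (G a)) (s≤s (proj₁ (V3-bounds i j k eq))) ⟩
    Σ< (suc (n ∸ i)) (G i)
      ≡⟨ Σ<-δ (suc (n ∸ i)) j (λ b → δ (n ∸ i ∸ b) k * F (i , b , n ∸ i ∸ b)) (s≤s (proj₁ (V3-coordinates i j k eq))) ⟩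
    δ (n ∸ i ∸ j) k * F (i , j , n ∸ i ∸ j)
      ≡⟨ cong (λ c → δ c k * F (i , j , c)) (proj₂ (V3-coordinates i j k eq)) ⟩
    δ k k * F (i , j , k)
      ≡⟨ trans (cong (_* F (i , j , k)) (δ-refl k)) (ℚP.*-identityˡ _) ⟩
    F (i , j , k) ∎
    where
    summand : Triple → ℚ
    summand (a , b , c) = F (a , b , c) * e i j k a b c
    G : ℕ → ℕ → ℚ
    G a b = δ b j * (δ (n ∸ a ∸ b) k * F (a , b , n ∸ a ∸ b))
    regroup : ∀ a b → F (a , b , n ∸ a ∸ b) * (δ a i * δ b j * δ (n ∸ a ∸ b) k) ≡ δ a i * G a b
    regroup a b = solve 4 (λ f x y z → f :* (x :* y :* z) := x :* (y :* (z :* f))) refl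
      (F (a , b , n ∸ a ∸ b)) (δ a i) (δ b j) (δ (n ∸ a ∸ b) k)

  All-V3⁺ : ∀ n (P : Triple → Set) → (∀ a b c → a ℕ.+ b ℕ.+ c ≡ n → P (a , b , c)) → All P (V3 n)
  All-V3⁺ n P h = AllP.concat⁺ (AllP.map⁺ (AllP.applyUpTo⁺₁ (λ i → i) (suc n) (λ {a} a≤n →
    AllP.map⁺ (AllP.applyUpTo⁺₁ (λ i → i) (suc (n ∸ a)) (λ {b} b≤ →
      h a b _ (V3-point a b (ℕP.≤-pred a≤n) (ℕP.≤-pred b≤)))))))

  All-V3⁻ : ∀ n (P : Triple → Set) → All P (V3 n) → ∀ a b c → a ℕ.+ b ℕ.+ c ≡ n → P (a , b , c)
  All-V3⁻ n P all a b c eq = subst (λ c → P (a , b , c)) (proj₂ (V3-coordinates a b c eq))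
    (AllP.applyUpTo⁻ (λ i → i) (suc (n ∸ a)) (AllP.map⁻ (AllP.applyUpTo⁻ (λ i → i) (suc n)
      (AllP.map⁻ {f = row} (AllP.concat⁻ {xss = map row (upTo (suc n))} all)) (s≤s (proj₁ (V3-bounds a b c eq)))))
      (s≤s (proj₁ (V3-coordinates a b c eq))))
    where
    row : ℕ → List Triple
    row a = map (λ b → (a , b , n ∸ a ∸ b)) (upTo (suc (n ∸ a)))

module InnerProduct where
  open import Data.Rational using (0ℚ; 1ℚ; _+_; _*_; _-_)
  import Data.Rational.Properties as ℚP
  open import Data.Rational.Solver using (module +-*-Solver)
  open +-*-Solver using (solve; _:+_; _:*_; _:-_; _:=_)
  open RationalFacts
  open Sums
  open Simplex
  open ≡-Reasoning

  Σ≤-δ-antidiagonal : ∀ m p q → p ℕ.+ q ≡ m → Σ≤ m (λ j → δ p j * δ q (m ∸ j)) ≡ 1ℚ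
  Σ≤-δ-antidiagonal m p q p+q≡m = begin
    Σ≤ m (λ j → δ p j * δ q (m ∸ j))        ≡⟨ Σ≤≡Σ< m (λ j → δ p j * δ q (m ∸ j)) ⟩
    Σ< (suc m) (λ j → δ p j * δ q (m ∸ j))  ≡⟨ Σ<-cong (suc m) (λ j _ → cong (_* δ q (m ∸ j)) (δ-comm p j)) ⟩
    Σ< (suc m) (λ j → δ j p * δ q (m ∸ j))  ≡⟨ Σ<-δ (suc m) p (λ j → δ q (m ∸ j)) (s≤s p≤m) ⟩
    δ q (m ∸ p)                             ≡⟨ cong (δ q) m∸p≡q ⟩
    δ q q                                   ≡⟨ δ-refl q ⟩
    1ℚ                                      ∎
    where
    p≤m : p ≤ m
    p≤m = subst (p ≤_) p+q≡m (ℕP.m≤m+n p q)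
    m∸p≡q : m ∸ p ≡ q
    m∸p≡q = subst (λ m → m ∸ p ≡ q) p+q≡m (ℕP.m+n∸m≡n p q)

  X-on-V3 : ∀ {n} i a b c → a ℕ.+ b ℕ.+ c ≡ n → X n i a b c ≡ δ a i
  X-on-V3 {n} i a b c eq = begin
    Σ≤ (n ∸ i) (λ j → δ a i * δ b j * δ c (n ∸ i ∸ j))   ≡⟨ Σ≤-cong (n ∸ i) (λ j → ℚP.*-assoc (δ a i) (δ b j) _) ⟩
    Σ≤ (n ∸ i) (λ j → δ a i * (δ b j * δ c (n ∸ i ∸ j))) ≡⟨ Σ≤-*ˡ (n ∸ i) (δ a i) _ ⟩
    δ a i * Σ≤ (n ∸ i) (λ j → δ b j * δ c (n ∸ i ∸ j))   ≡⟨ δ*-absorb a i _ line-sum ⟩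
    δ a i                                                ∎
    where
    line-sum : a ≡ i → Σ≤ (n ∸ i) (λ j → δ b j * δ c (n ∸ i ∸ j)) ≡ 1ℚ
    line-sum refl = Σ≤-δ-antidiagonal (n ∸ a) b c (sym (n∸a≡b+c a b c eq))

  Y-on-V3 : ∀ {n} i a b c → a ℕ.+ b ℕ.+ c ≡ n → Y n i a b c ≡ δ b i
  Y-on-V3 {n} i a b c eq = begin
    Σ≤ (n ∸ i) (λ j → δ a j * δ b i * δ c (n ∸ i ∸ j))   ≡⟨ Σ≤-cong (n ∸ i) (λ j → regroup (δ a j) (δ b i) _) ⟩
    Σ≤ (n ∸ i) (λ j → δ b i * (δ a j * δ c (n ∸ i ∸ j))) ≡⟨ Σ≤-*ˡ (n ∸ i) (δ b i) _ ⟩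
    δ b i * Σ≤ (n ∸ i) (λ j → δ a j * δ c (n ∸ i ∸ j))   ≡⟨ δ*-absorb b i _ line-sum ⟩
    δ b i                                                ∎
    where
    regroup : ∀ x y z → x * y * z ≡ y * (x * z)
    regroup = solve 3 (λ x y z → x :* y :* z := y :* (x :* z)) refl
    line-sum : b ≡ i → Σ≤ (n ∸ i) (λ j → δ a j * δ c (n ∸ i ∸ j)) ≡ 1ℚ
    line-sum refl = Σ≤-δ-antidiagonal (n ∸ b) a c (sym (n∸b≡a+c a b c eq))

  Z-on-V3 : ∀ {n} i a b c → a ℕ.+ b ℕ.+ c ≡ n → Z n i a b c ≡ δ c i
  Z-on-V3 {n} i a b c eq = begin
    Σ≤ (n ∸ i) (λ j → δ a j * δ b (n ∸ i ∸ j) * δ c i)   ≡⟨ Σ≤-cong (n ∸ i) (λ j → ℚP.*-comm (δ a j * _) (δ c i)) ⟩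
    Σ≤ (n ∸ i) (λ j → δ c i * (δ a j * δ b (n ∸ i ∸ j))) ≡⟨ Σ≤-*ˡ (n ∸ i) (δ c i) _ ⟩
    δ c i * Σ≤ (n ∸ i) (λ j → δ a j * δ b (n ∸ i ∸ j))   ≡⟨ δ*-absorb c i _ line-sum ⟩
    δ c i                                                ∎
    where
    line-sum : c ≡ i → Σ≤ (n ∸ i) (λ j → δ a j * δ b (n ∸ i ∸ j)) ≡ 1ℚ
    line-sum refl = Σ≤-δ-antidiagonal (n ∸ c) a b (sym (n∸c≡a+b a b c eq))

  dot-comm : ∀ n u v → dot n u v ≡ dot n v u
  dot-comm n u v = ΣList-cong (V3 n) (λ { (a , b , c) → ℚP.*-comm (u a b c) (v a b c) })

  dot-congʳ : ∀ n u {v w} → v ≈[ n ] w → dot n u v ≡ dot n u w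
  dot-congʳ n u {v} {w} v≈w =
    ΣV3-cong n (λ { (a , b , c) → u a b c * v a b c }) (λ { (a , b , c) → u a b c * w a b c })
      (λ a b c eq → cong (u a b c *_) (v≈w a b c eq))

  dot-congˡ : ∀ n {u v} w → u ≈[ n ] v → dot n u w ≡ dot n v w
  dot-congˡ n {u} {v} w u≈v = trans (dot-comm n u w) (trans (dot-congʳ n w u≈v) (dot-comm n w v))

  dot-zeroʳ : ∀ n u → dot n u (λ _ _ _ → 0ℚ) ≡ 0ℚ
  dot-zeroʳ n u = ΣList-zero (V3 n) _ (λ { (a , b , c) → ℚP.*-zeroʳ (u a b c) })

  dot-linearʳ : ∀ n u s (v w : Vect) → dot n u (λ a b c → s * v a b c + w a b c) ≡ s * dot n u v + dot n u w
  dot-linearʳ n u s v w = begin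
    dot n u (λ a b c → s * v a b c + w a b c)
      ≡⟨ ΣList-cong (V3 n) (λ { (a , b , c) → solve 4 (λ s x y z → x :* (s :* y :+ z) := s :* (x :* y) :+ x :* z)
                                                    refl s (u a b c) (v a b c) (w a b c) }) ⟩
    ΣList (V3 n) (λ { (a , b , c) → s * (u a b c * v a b c) + u a b c * w a b c })
      ≡⟨ ΣList-+ (V3 n) (λ { (a , b , c) → s * (u a b c * v a b c) }) (λ { (a , b , c) → u a b c * w a b c }) ⟩
    ΣList (V3 n) (λ { (a , b , c) → s * (u a b c * v a b c) }) + dot n u w
      ≡⟨ cong (_+ dot n u w) (ΣList-*ˡ (V3 n) s (λ { (a , b , c) → u a b c * v a b c })) ⟩
    s * dot n u v + dot n u w ∎

  dot-⊕ʳ : ∀ n u v w → dot n u (v ⊕ w) ≡ dot n u v + dot n u w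
  dot-⊕ʳ n u v w = trans (ΣList-cong (V3 n) (λ { (a , b , c) → ℚP.*-distribˡ-+ (u a b c) (v a b c) (w a b c) }))
                         (ΣList-+ (V3 n) (λ { (a , b , c) → u a b c * v a b c }) (λ { (a , b , c) → u a b c * w a b c }))

  dot-⊖ʳ : ∀ n u v w → dot n u (v ⊖ w) ≡ dot n u v - dot n u w
  dot-⊖ʳ n u v w = trans (ΣList-cong (V3 n) (λ { (a , b , c) → solve 3 (λ x y z → x :* (y :- z) := x :* y :- x :* z)
                                                                  refl (u a b c) (v a b c) (w a b c) }))
                         (ΣList-- (V3 n) (λ { (a , b , c) → u a b c * v a b c }) (λ { (a , b , c) → u a b c * w a b c }))

  dot-⊖ˡ : ∀ n u v w → dot n (u ⊖ v) w ≡ dot n u w - dot n v w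
  dot-⊖ˡ n u v w = trans (dot-comm n (u ⊖ v) w) (trans (dot-⊖ʳ n w u v) (cong₂ _-_ (dot-comm n w u) (dot-comm n w v)))

  dot-eʳ : ∀ n v i j k → i ℕ.+ j ℕ.+ k ≡ n → dot n v (e i j k) ≡ v i j k
  dot-eʳ n v i j k = ΣV3-δ n i j k (λ { (a , b , c) → v a b c })

module Hexagons where
  open import Data.Rational using (ℚ; 0ℚ; _+_; _*_; _-_; -_)
  import Data.Rational.Properties as ℚP
  open import Data.Rational.Solver using (module +-*-Solver)
  open +-*-Solver using (solve; _:+_; _:-_; :-_; _:=_; con)
  open RationalFacts
  open Sums
  open Simplex
  open InnerProduct
  open ≡-Reasoning

  hexagon : Vect → ℕ → ℕ → ℕ → ℚ
  hexagon v a b c =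
    v a (suc b) (suc (suc c)) - v (suc a) b (suc (suc c)) + v (suc (suc a)) b (suc c)
    - v (suc (suc a)) (suc b) c + v (suc a) (suc (suc b)) c - v a (suc (suc b)) (suc c)

  vertex-on-V3 : ∀ i j k {a b c n} → i ℕ.+ j ℕ.+ k ≡ 3 → 3 ℕ.+ (a ℕ.+ b ℕ.+ c) ≡ n →
                 (i ℕ.+ a) ℕ.+ (j ℕ.+ b) ℕ.+ (k ℕ.+ c) ≡ n
  vertex-on-V3 i j k {a} {b} {c} ijk≡3 refl = begin
    (i ℕ.+ a) ℕ.+ (j ℕ.+ b) ℕ.+ (k ℕ.+ c) ≡⟨ regroup i j k a b c ⟩
    (i ℕ.+ j ℕ.+ k) ℕ.+ (a ℕ.+ b ℕ.+ c)   ≡⟨ cong (ℕ._+ (a ℕ.+ b ℕ.+ c)) ijk≡3 ⟩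
    3 ℕ.+ (a ℕ.+ b ℕ.+ c)                 ∎
    where
    open ℕSolver.+-*-Solver using () renaming (solve to ℕsolve; _:+_ to _⊕′_; _:=_ to _=′_)
    regroup : ∀ i j k a b c → (i ℕ.+ a) ℕ.+ (j ℕ.+ b) ℕ.+ (k ℕ.+ c) ≡ (i ℕ.+ j ℕ.+ k) ℕ.+ (a ℕ.+ b ℕ.+ c)
    regroup = ℕsolve 6 (λ i j k a b c → (i ⊕′ a) ⊕′ (j ⊕′ b) ⊕′ (k ⊕′ c) =′ (i ⊕′ j ⊕′ k) ⊕′ (a ⊕′ b ⊕′ c)) refl

  hexagon-cong : ∀ {n} a b c {u v : Vect} → 3 ℕ.+ (a ℕ.+ b ℕ.+ c) ≡ n → u ≈[ n ] v → hexagon u a b c ≡ hexagon v a b c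
  hexagon-cong a b c {u} {v} eq u≈v =
    cong₂ _-_ (cong₂ _+_ (cong₂ _-_ (cong₂ _+_ (cong₂ _-_ (at 0 1 2 refl) (at 1 0 2 refl)) (at 2 0 1 refl)) (at 2 1 0 refl))
      (at 1 2 0 refl)) (at 0 2 1 refl)
    where
    at : ∀ i j k → i ℕ.+ j ℕ.+ k ≡ 3 → u (i ℕ.+ a) (j ℕ.+ b) (k ℕ.+ c) ≡ v (i ℕ.+ a) (j ℕ.+ b) (k ℕ.+ c)
    at i j k ijk≡3 = u≈v (i ℕ.+ a) (j ℕ.+ b) (k ℕ.+ c) (vertex-on-V3 i j k ijk≡3 eq)

  dot-alternating : ∀ n v u₁ u₂ u₃ u₄ u₅ u₆ →
    dot n v (((((u₁ ⊖ u₂) ⊕ u₃) ⊖ u₄) ⊕ u₅) ⊖ u₆)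
      ≡ dot n v u₁ - dot n v u₂ + dot n v u₃ - dot n v u₄ + dot n v u₅ - dot n v u₆
  dot-alternating n v u₁ u₂ u₃ u₄ u₅ u₆ = begin
    ⟨ ((((u₁ ⊖ u₂) ⊕ u₃) ⊖ u₄) ⊕ u₅) ⊖ u₆ ⟩
      ≡⟨ dot-⊖ʳ n v _ u₆ ⟩
    ⟨ (((u₁ ⊖ u₂) ⊕ u₃) ⊖ u₄) ⊕ u₅ ⟩ - ⟨ u₆ ⟩
      ≡⟨ cong (_- ⟨ u₆ ⟩) (dot-⊕ʳ n v _ u₅) ⟩
    ⟨ ((u₁ ⊖ u₂) ⊕ u₃) ⊖ u₄ ⟩ + ⟨ u₅ ⟩ - ⟨ u₆ ⟩
      ≡⟨ cong (λ t → t + ⟨ u₅ ⟩ - ⟨ u₆ ⟩) (dot-⊖ʳ n v _ u₄) ⟩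
    ⟨ (u₁ ⊖ u₂) ⊕ u₃ ⟩ - ⟨ u₄ ⟩ + ⟨ u₅ ⟩ - ⟨ u₆ ⟩
      ≡⟨ cong (λ t → t - ⟨ u₄ ⟩ + ⟨ u₅ ⟩ - ⟨ u₆ ⟩) (dot-⊕ʳ n v _ u₃) ⟩
    ⟨ u₁ ⊖ u₂ ⟩ + ⟨ u₃ ⟩ - ⟨ u₄ ⟩ + ⟨ u₅ ⟩ - ⟨ u₆ ⟩
      ≡⟨ cong (λ t → t + ⟨ u₃ ⟩ - ⟨ u₄ ⟩ + ⟨ u₅ ⟩ - ⟨ u₆ ⟩) (dot-⊖ʳ n v u₁ u₂) ⟩
    ⟨ u₁ ⟩ - ⟨ u₂ ⟩ + ⟨ u₃ ⟩ - ⟨ u₄ ⟩ + ⟨ u₅ ⟩ - ⟨ u₆ ⟩ ∎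
    where
    ⟨_⟩ : Vect → ℚ
    ⟨ u ⟩ = dot n v u

  dot-H : ∀ n v a b c → 3 ℕ.+ (a ℕ.+ b ℕ.+ c) ≡ n → dot n v (H (suc a) (suc b) (suc c)) ≡ hexagon v a b c
  dot-H n v a b c eq =
    trans (dot-alternating n v _ _ _ _ _ _) (hexagon-cong a b c eq (λ p q r → dot-eʳ n v p q r))

  hexagon-⊖ : ∀ u v a b c → hexagon (u ⊖ v) a b c ≡ hexagon u a b c - hexagon v a b c
  hexagon-⊖ u v a b c = solve 12 (λ u₁ u₂ u₃ u₄ u₅ u₆ v₁ v₂ v₃ v₄ v₅ v₆ →
      (u₁ :- v₁) :- (u₂ :- v₂) :+ (u₃ :- v₃) :- (u₄ :- v₄) :+ (u₅ :- v₅) :- (u₆ :- v₆)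
        := (u₁ :- u₂ :+ u₃ :- u₄ :+ u₅ :- u₆) :- (v₁ :- v₂ :+ v₃ :- v₄ :+ v₅ :- v₆)) refl
    (u a (suc b) (suc (suc c))) (u (suc a) b (suc (suc c))) (u (suc (suc a)) b (suc c))
    (u (suc (suc a)) (suc b) c) (u (suc a) (suc (suc b)) c) (u a (suc (suc b)) (suc c))
    (v a (suc b) (suc (suc c))) (v (suc a) b (suc (suc c))) (v (suc (suc a)) b (suc c))
    (v (suc (suc a)) (suc b) c) (v (suc a) (suc (suc b)) c) (v a (suc (suc b)) (suc c))

  Separable : ℕ → Vect → Set
  Separable n v = ∃ λ (x : ℕ → ℚ) → ∃ λ (y : ℕ → ℚ) → ∃ λ (z : ℕ → ℚ) → v ≈[ n ] (λ a b c → x a + y b + z c)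

  Separable-≈ : ∀ {n u v} → u ≈[ n ] v → Separable n v → Separable n u
  Separable-≈ u≈v (x , y , z , v≈xyz) = x , y , z , λ a b c eq → trans (u≈v a b c eq) (v≈xyz a b c eq)

  hexagon-separable : ∀ {n} v → Separable n v → ∀ a b c → 3 ℕ.+ (a ℕ.+ b ℕ.+ c) ≡ n → hexagon v a b c ≡ 0ℚ
  hexagon-separable v (x , y , z , v≈xyz) a b c eq = trans (hexagon-cong a b c eq v≈xyz)
    (solve 9 (λ x₀ x₁ x₂ y₀ y₁ y₂ z₀ z₁ z₂ →
        x₀ :+ y₁ :+ z₂ :- (x₁ :+ y₀ :+ z₂) :+ (x₂ :+ y₀ :+ z₁) :- (x₂ :+ y₁ :+ z₀) :+ (x₁ :+ y₂ :+ z₀) :- (x₀ :+ y₂ :+ z₁)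
          := con 0ℚ) refl
      (x a) (x (suc a)) (x (suc (suc a))) (y b) (y (suc b)) (y (suc (suc b))) (z c) (z (suc c)) (z (suc (suc c))))

  Frame : ℕ → ℕ → Set
  Frame a c = c ≤ 1 ⊎ a ≡ 0

  hexagon-rigid : ∀ n u → (∀ a b c → 3 ℕ.+ (a ℕ.+ b ℕ.+ c) ≡ n → hexagon u a b c ≡ 0ℚ) →
                  (∀ a b c → a ℕ.+ b ℕ.+ c ≡ n → Frame a c → u a b c ≡ 0ℚ) → u ≈[ n ] (λ _ _ _ → 0ℚ)
  hexagon-rigid n u hexagon≡0 frame≡0 a b c = proj₁ (levels c) a b
    where
    Level : ℕ → Set
    Level c = ∀ a b → a ℕ.+ b ℕ.+ c ≡ n → u a b c ≡ 0ℚ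

    isolate : ∀ {p₁ p₂ p₃ p₄ p₅ p₆ : ℚ} → p₁ ≡ 0ℚ → p₃ ≡ 0ℚ → p₄ ≡ 0ℚ → p₅ ≡ 0ℚ → p₆ ≡ 0ℚ →
              p₁ - p₂ + p₃ - p₄ + p₅ - p₆ ≡ 0ℚ → p₂ ≡ 0ℚ
    isolate {p₂ = p₂} refl refl refl refl refl sum≡0 =
      trans (solve 1 (λ p → p := :- (con 0ℚ :- p :+ con 0ℚ :- con 0ℚ :+ con 0ℚ :- con 0ℚ)) refl p₂) (cong -_ sum≡0)

    -- the hexagon centred at (a + 1, b + 1, c + 1) determines u at its vertex (a + 1, b, c + 2)
    next : ∀ c → Level c → Level (suc c) → Level (suc (suc c))
    next c level₀ level₁ zero    b eq = frame≡0 0 b _ eq (inj₂ refl)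
    next c level₀ level₁ (suc a) b eq = isolate
      (next c level₀ level₁ a (suc b) (vertex 0 1 2 refl))
      (level₁ (suc (suc a)) b (vertex 2 0 1 refl)) (level₀ (suc (suc a)) (suc b) (vertex 2 1 0 refl))
      (level₀ (suc a) (suc (suc b)) (vertex 1 2 0 refl)) (level₁ a (suc (suc b)) (vertex 0 2 1 refl))
      (hexagon≡0 a b c centre)
      where
      centre : 3 ℕ.+ (a ℕ.+ b ℕ.+ c) ≡ n
      centre = trans (sym (vertex-on-V3 1 0 2 {a} {b} {c} refl refl)) eq
      vertex : ∀ i j k → i ℕ.+ j ℕ.+ k ≡ 3 → (i ℕ.+ a) ℕ.+ (j ℕ.+ b) ℕ.+ (k ℕ.+ c) ≡ n
      vertex i j k ijk≡3 = vertex-on-V3 i j k ijk≡3 centre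

    levels : ∀ c → Level c × Level (suc c)
    levels zero    = (λ a b eq → frame≡0 a b 0 eq (inj₁ z≤n)) , (λ a b eq → frame≡0 a b 1 eq (inj₁ (s≤s z≤n)))
    levels (suc c) = proj₂ (levels c) , next c (proj₁ (levels c)) (proj₂ (levels c))

  module FrameExtension (n : ℕ) (v : Vect) where
    -- w telescopes the differences between the two lowest levels, so that x a + y b + z c
    -- reproduces v on c = 0 and on c = 1; z takes care of the side a = 0.
    w : ℕ → ℚ
    w zero    = v 0 n 0
    w (suc a) = w a + v a (n ∸ 1 ∸ a) 1 - v a (n ∸ a) 0

    x y z : ℕ → ℚ
    x a = v a (n ∸ a) 0 - w a
    y b = w (n ∸ b)
    z c = v 0 (n ∸ c) c - w c

    extension : Vect
    extension a b c = x a + y b + z c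

    extension-on-frame : ∀ a b c → a ℕ.+ b ℕ.+ c ≡ n → Frame a c → extension a b c ≡ v a b c
    extension-on-frame a b zero eq (inj₁ z≤n) = begin
      (v a (n ∸ a) 0 - w a) + w (n ∸ b) + (v 0 n 0 - v 0 n 0)
        ≡⟨ cong₂ (λ p q → (v a p 0 - w a) + w q + (v 0 n 0 - v 0 n 0)) n∸a≡b n∸b≡a ⟩
      (v a b 0 - w a) + w a + (v 0 n 0 - v 0 n 0)
        ≡⟨ solve 3 (λ V W Q → (V :- W) :+ W :+ (Q :- Q) := V) refl (v a b 0) (w a) (v 0 n 0) ⟩
      v a b 0 ∎
      where
      n∸a≡b : n ∸ a ≡ b
      n∸a≡b = trans (n∸a≡b+c a b 0 eq) (ℕP.+-identityʳ b)
      n∸b≡a : n ∸ b ≡ a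
      n∸b≡a = trans (n∸b≡a+c a b 0 eq) (ℕP.+-identityʳ a)
    extension-on-frame a b (suc zero) eq (inj₁ (s≤s z≤n)) = begin
      (v a (n ∸ a) 0 - w a) + w (n ∸ b) + (v 0 (n ∸ 1) 1 - w 1)
        ≡⟨ cong (λ q → (v a (n ∸ a) 0 - w a) + w q + (v 0 (n ∸ 1) 1 - w 1)) n∸b≡1+a ⟩
      (v a (n ∸ a) 0 - w a) + (w a + v a (n ∸ 1 ∸ a) 1 - v a (n ∸ a) 0) + (v 0 (n ∸ 1) 1 - w 1)
        ≡⟨ cong (λ q → (v a (n ∸ a) 0 - w a) + (w a + v a q 1 - v a (n ∸ a) 0) + (v 0 (n ∸ 1) 1 - w 1)) n∸1∸a≡b ⟩
      (v a (n ∸ a) 0 - w a) + (w a + v a b 1 - v a (n ∸ a) 0) + (v 0 (n ∸ 1) 1 - (v 0 n 0 + v 0 (n ∸ 1) 1 - v 0 n 0))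
        ≡⟨ solve 5 (λ V₀ W V₁ P Q → (V₀ :- W) :+ (W :+ V₁ :- V₀) :+ (P :- (Q :+ P :- Q)) := V₁) refl
             (v a (n ∸ a) 0) (w a) (v a b 1) (v 0 (n ∸ 1) 1) (v 0 n 0) ⟩
      v a b 1 ∎
      where
      n∸b≡1+a : n ∸ b ≡ suc a
      n∸b≡1+a = trans (n∸b≡a+c a b 1 eq) (ℕP.+-comm a 1)
      n∸1∸a≡b : n ∸ 1 ∸ a ≡ b
      n∸1∸a≡b = trans (cong (_∸ a) (n∸c≡a+b a b 1 eq)) (ℕP.m+n∸m≡n a b)
    extension-on-frame zero b c eq (inj₂ refl) = begin
      (v 0 n 0 - v 0 n 0) + w (n ∸ b) + (v 0 (n ∸ c) c - w c)
        ≡⟨ cong₂ (λ p q → (v 0 n 0 - v 0 n 0) + w p + (v 0 q c - w c)) (n∸b≡a+c 0 b c eq) (n∸c≡a+b 0 b c eq) ⟩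
      (v 0 n 0 - v 0 n 0) + w c + (v 0 b c - w c)
        ≡⟨ solve 3 (λ Q W V → (Q :- Q) :+ W :+ (V :- W) := V) refl (v 0 n 0) (w c) (v 0 b c) ⟩
      v 0 b c ∎
    extension-on-frame a b (suc (suc c)) eq (inj₁ (s≤s ()))

    extension-separable : Separable n extension
    extension-separable = x , y , z , λ _ _ _ _ → refl

  hexagons⇒separable : ∀ n v → (∀ a b c → 3 ℕ.+ (a ℕ.+ b ℕ.+ c) ≡ n → hexagon v a b c ≡ 0ℚ) → Separable n v
  hexagons⇒separable n v hexagon≡0 = Separable-≈ v≈extension extension-separable
    where
    open FrameExtension n v
    difference≡0 : (v ⊖ extension) ≈[ n ] (λ _ _ _ → 0ℚ)
    difference≡0 = hexagon-rigid n (v ⊖ extension)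
      (λ a b c eq → begin
        hexagon (v ⊖ extension) a b c              ≡⟨ hexagon-⊖ v extension a b c ⟩
        hexagon v a b c - hexagon extension a b c  ≡⟨ cong₂ _-_ (hexagon≡0 a b c eq) (hexagon-separable extension extension-separable a b c eq) ⟩
        0ℚ - 0ℚ                                    ≡⟨⟩
        0ℚ                                         ∎)
      (λ a b c eq frame → trans (cong (_-_ (v a b c)) (extension-on-frame a b c eq frame)) (ℚP.+-inverseʳ (v a b c)))
    v≈extension : v ≈[ n ] extension
    v≈extension a b c eq = x-y≡0⇒x≡y _ _ (difference≡0 a b c eq)

module LinearCombinations where
  open import Data.Rational using (ℚ; 0ℚ; _+_; _*_)
  import Data.Rational.Properties as ℚP
  open Sums
  open InnerProduct
  open ≡-Reasoning

  coefficientsOf : ∀ {A : Set} (L : List A) (f : A → Vect) → (A → ℚ) → Fin (length (map f L)) → ℚ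
  coefficientsOf (t ∷ L) f κ zero    = κ t
  coefficientsOf (t ∷ L) f κ (suc l) = coefficientsOf L f κ l

  lincomb-coefficientsOf : ∀ {A : Set} (L : List A) (f : A → Vect) (κ : A → ℚ) a b c →
                           lincomb (map f L) (coefficientsOf L f κ) a b c ≡ ΣList L (λ t → κ t * f t a b c)
  lincomb-coefficientsOf []      f κ a b c = refl
  lincomb-coefficientsOf (t ∷ L) f κ a b c = cong (κ t * f t a b c +_) (lincomb-coefficientsOf L f κ a b c)

  coefficientAt : (g : ℕ → Vect) (h : ℕ → ℕ) (m : ℕ) → (Fin (length (map g (applyUpTo h m))) → ℚ) → ℕ → ℚ
  coefficientAt g h zero    c i       = 0ℚ
  coefficientAt g h (suc m) c zero    = c zero
  coefficientAt g h (suc m) c (suc i) = coefficientAt g (h ∘ suc) m (c ∘ suc) i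

  lincomb-coefficientAt : ∀ g h m c a b d →
    lincomb (map g (applyUpTo h m)) c a b d ≡ Σ< m (λ i → coefficientAt g h m c i * g (h i) a b d)
  lincomb-coefficientAt g h zero    c a b d = refl
  lincomb-coefficientAt g h (suc m) c a b d =
    cong (c zero * g (h 0) a b d +_) (lincomb-coefficientAt g (h ∘ suc) m (c ∘ suc) a b d)

  coefficientAt≡0⇒coefficients≡0 : ∀ g h m c → (∀ i → i < m → coefficientAt g h m c i ≡ 0ℚ) → ∀ l → c l ≡ 0ℚ
  coefficientAt≡0⇒coefficients≡0 g h (suc m) c c≡0 zero    = c≡0 0 (s≤s z≤n)
  coefficientAt≡0⇒coefficients≡0 g h (suc m) c c≡0 (suc l) =
    coefficientAt≡0⇒coefficients≡0 g (h ∘ suc) m (c ∘ suc) (λ i i<m → c≡0 (suc i) (s≤s i<m)) l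

  append : (L M : List Vect) → (Fin (length L) → ℚ) → (Fin (length M) → ℚ) → Fin (length (L ++ M)) → ℚ
  append []      M c d         = d
  append (u ∷ L) M c d zero    = c zero
  append (u ∷ L) M c d (suc l) = append L M (c ∘ suc) d l

  lincomb-append : ∀ L M c d a b e → lincomb (L ++ M) (append L M c d) a b e ≡ lincomb L c a b e + lincomb M d a b e
  lincomb-append []      M c d a b e = sym (ℚP.+-identityˡ _)
  lincomb-append (u ∷ L) M c d a b e =
    trans (cong (c zero * u a b e +_) (lincomb-append L M (c ∘ suc) d a b e)) (sym (ℚP.+-assoc (c zero * u a b e) _ _))

  takeˡ : (L M : List Vect) → (Fin (length (L ++ M)) → ℚ) → Fin (length L) → ℚ
  takeˡ (u ∷ L) M c zero    = c zero
  takeˡ (u ∷ L) M c (suc l) = takeˡ L M (c ∘ suc) l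

  takeʳ : (L M : List Vect) → (Fin (length (L ++ M)) → ℚ) → Fin (length M) → ℚ
  takeʳ []      M c = c
  takeʳ (u ∷ L) M c = takeʳ L M (c ∘ suc)

  lincomb-++ : ∀ L M c a b e → lincomb (L ++ M) c a b e ≡ lincomb L (takeˡ L M c) a b e + lincomb M (takeʳ L M c) a b e
  lincomb-++ []      M c a b e = sym (ℚP.+-identityˡ _)
  lincomb-++ (u ∷ L) M c a b e =
    trans (cong (c zero * u a b e +_) (lincomb-++ L M (c ∘ suc) a b e)) (sym (ℚP.+-assoc (c zero * u a b e) _ _))

  take≡0⇒coefficients≡0 : ∀ L M c → (∀ l → takeˡ L M c l ≡ 0ℚ) → (∀ l → takeʳ L M c l ≡ 0ℚ) → ∀ l → c l ≡ 0ℚ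
  take≡0⇒coefficients≡0 []      M c cˡ≡0 cʳ≡0 l       = cʳ≡0 l
  take≡0⇒coefficients≡0 (u ∷ L) M c cˡ≡0 cʳ≡0 zero    = cˡ≡0 zero
  take≡0⇒coefficients≡0 (u ∷ L) M c cˡ≡0 cʳ≡0 (suc l) = take≡0⇒coefficients≡0 L M (c ∘ suc) (cˡ≡0 ∘ suc) cʳ≡0 l

  dot-lincombʳ : ∀ n u (L : List Vect) c → All (λ w → dot n u w ≡ 0ℚ) L → dot n u (lincomb L c) ≡ 0ℚ
  dot-lincombʳ n u []      c []          = dot-zeroʳ n u
  dot-lincombʳ n u (w ∷ L) c (uw≡0 ∷ ⊥s) = begin
    dot n u (lincomb (w ∷ L) c)                               ≡⟨ dot-linearʳ n u (c zero) w (lincomb L (c ∘ suc)) ⟩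
    c zero * dot n u w + dot n u (lincomb L (c ∘ suc))        ≡⟨ cong₂ (λ p q → c zero * p + q) uw≡0 (dot-lincombʳ n u L (c ∘ suc) ⊥s) ⟩
    c zero * 0ℚ + 0ℚ                                          ≡⟨ cong (_+ 0ℚ) (ℚP.*-zeroʳ (c zero)) ⟩
    0ℚ                                                        ∎

module Relations where
  open import Data.Rational using (ℚ; 0ℚ; 1ℚ; _+_; _*_; _-_; -_)
  import Data.Rational.Properties as ℚP
  open import Data.Rational.Solver using (module +-*-Solver)
  open +-*-Solver using (solve; _:+_; _:*_; _:-_; :-_; _:=_; con)
  open RationalFacts
  open Simplex
  open ≡-Reasoning

  -- (x, y, z) are the coefficients of α (ΣX − ΣY) + β (ΣY − ΣZ) + γ (n ΣX − Σ i (X_i + Y_i + Z_i))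
  StandardRelation : ℕ → ℚ → ℚ → ℚ → (x y z : ℕ → ℚ) → Set
  StandardRelation n α β γ x y z = ∀ i → i ≤ n →
    (x i ≡ α + γ * ⟦ n ∸ i ⟧) × (y i ≡ (β - α) - γ * ⟦ i ⟧) × (z i ≡ - β - γ * ⟦ i ⟧)

  standardRelation-vanishes : ∀ {n} α β γ a b c → a ℕ.+ b ℕ.+ c ≡ n →
    (α + γ * ⟦ n ∸ a ⟧) + ((β - α) - γ * ⟦ b ⟧) + (- β - γ * ⟦ c ⟧) ≡ 0ℚ
  standardRelation-vanishes α β γ a b c eq = begin
    (α + γ * ⟦ _ ∸ a ⟧) + ((β - α) - γ * ⟦ b ⟧) + (- β - γ * ⟦ c ⟧)
      ≡⟨ cong (λ t → (α + γ * t) + ((β - α) - γ * ⟦ b ⟧) + (- β - γ * ⟦ c ⟧)) (trans (cong ⟦_⟧ (n∸a≡b+c a b c eq)) (⟦⟧-homo-+ b c)) ⟩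
    (α + γ * (⟦ b ⟧ + ⟦ c ⟧)) + ((β - α) - γ * ⟦ b ⟧) + (- β - γ * ⟦ c ⟧)
      ≡⟨ solve 5 (λ α β γ B C → α :+ γ :* (B :+ C) :+ ((β :- α) :- γ :* B) :+ (:- β :- γ :* C) := con 0ℚ) refl α β γ ⟦ b ⟧ ⟦ c ⟧ ⟩
    0ℚ ∎

  arithmetic-progression : ∀ n (f : ℕ → ℚ) d → (∀ j → suc j ≤ n → f (suc j) ≡ f j - d) →
                           ∀ i → i ≤ n → f i ≡ f 0 - d * ⟦ i ⟧
  arithmetic-progression n f d step zero    _     = solve 2 (λ f d → f := f :- d :* con 0ℚ) refl (f 0) d
  arithmetic-progression n f d step (suc i) 1+i≤n = begin
    f (suc i)                   ≡⟨ step i 1+i≤n ⟩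
    f i - d                     ≡⟨ cong (_- d) (arithmetic-progression n f d step i (ℕP.<⇒≤ 1+i≤n)) ⟩
    f 0 - d * ⟦ i ⟧ - d         ≡⟨ solve 3 (λ f d I → f :- d :* I :- d := f :- d :* (con 1ℚ :+ I)) refl (f 0) d ⟦ i ⟧ ⟩
    f 0 - d * (1ℚ + ⟦ i ⟧)      ≡⟨ cong (λ t → f 0 - d * t) (sym (⟦⟧-homo-+ 1 i)) ⟩
    f 0 - d * ⟦ suc i ⟧         ∎

  complement-on-V3 : ∀ {n} k b c → b ℕ.+ c ≡ k → k ≤ n → n ∸ k ℕ.+ b ℕ.+ c ≡ n
  complement-on-V3 {n} k b c refl k≤n = trans (ℕP.+-assoc (n ∸ k) b c) (ℕP.m∸n+n≡m k≤n)

  relation⇒standardRelation : ∀ m (x y z : ℕ → ℚ) → (∀ a b c → a ℕ.+ b ℕ.+ c ≡ suc m → x a + y b + z c ≡ 0ℚ) →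
                              StandardRelation (suc m) (x (suc m)) (- z 0) (z 0 - z 1) x y z
  relation⇒standardRelation m x y z relation i i≤n = x-formula , y-formula i i≤n , z-formula i i≤n
    where
    n : ℕ
    n = suc m
    α β γ : ℚ
    α = x n
    β = - z 0
    γ = z 0 - z 1

    -- two relations at the same first coordinate differ by a step along y, resp. z
    y-step : ∀ j → suc j ≤ n → y (suc j) ≡ y j - γ
    y-step j 1+j≤n = begin
      y (suc j)
        ≡⟨ solve 5 (λ A Y₁ Y₀ Z₀ Z₁ → Y₁ := (A :+ Y₁ :+ Z₀) :- (A :+ Y₀ :+ Z₁) :+ (Y₀ :- (Z₀ :- Z₁))) refl
             (x (n ∸ suc j)) (y (suc j)) (y j) (z 0) (z 1) ⟩
      (x (n ∸ suc j) + y (suc j) + z 0) - (x (n ∸ suc j) + y j + z 1) + (y j - γ)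
        ≡⟨ cong₂ (λ p q → p - q + (y j - γ))
             (relation _ (suc j) 0 (complement-on-V3 (suc j) (suc j) 0 (ℕP.+-identityʳ (suc j)) 1+j≤n))
             (relation _ j 1 (complement-on-V3 (suc j) j 1 (ℕP.+-comm j 1) 1+j≤n)) ⟩
      0ℚ - 0ℚ + (y j - γ)
        ≡⟨ ℚP.+-identityˡ _ ⟩
      y j - γ ∎

    z-step : ∀ j → suc j ≤ n → z (suc j) ≡ z j - γ
    z-step j 1+j≤n = begin
      z (suc j)
        ≡⟨ solve 5 (λ A Z₁ Z₀ Y₀ Y₁ → Z₁ := (A :+ Y₀ :+ Z₁) :- (A :+ Y₁ :+ Z₀) :+ (Z₀ :- (Y₀ :- Y₁))) refl
             (x (n ∸ suc j)) (z (suc j)) (z j) (y 0) (y 1) ⟩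
      (x (n ∸ suc j) + y 0 + z (suc j)) - (x (n ∸ suc j) + y 1 + z j) + (z j - (y 0 - y 1))
        ≡⟨ cong₂ (λ p q → p - q + (z j - (y 0 - y 1)))
             (relation _ 0 (suc j) (complement-on-V3 (suc j) 0 (suc j) refl 1+j≤n))
             (relation _ 1 j (complement-on-V3 (suc j) 1 j refl 1+j≤n)) ⟩
      0ℚ - 0ℚ + (z j - (y 0 - y 1))
        ≡⟨ cong (λ t → 0ℚ - 0ℚ + (z j - (y 0 - t))) (y-step 0 (s≤s z≤n)) ⟩
      0ℚ - 0ℚ + (z j - (y 0 - (y 0 - γ)))
        ≡⟨ solve 3 (λ Z Y G → con 0ℚ :- con 0ℚ :+ (Z :- (Y :- (Y :- G))) := Z :- G) refl (z j) (y 0) γ ⟩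
      z j - γ ∎

    y₀ : y 0 ≡ β - α
    y₀ = begin
      y 0                           ≡⟨ solve 3 (λ X Y Z → Y := (X :+ Y :+ Z) :+ (:- Z :- X)) refl (x n) (y 0) (z 0) ⟩
      (x n + y 0 + z 0) + (β - α)   ≡⟨ cong (_+ (β - α)) (relation n 0 0 (trans (ℕP.+-identityʳ (n ℕ.+ 0)) (ℕP.+-identityʳ n))) ⟩
      0ℚ + (β - α)                  ≡⟨ ℚP.+-identityˡ _ ⟩
      β - α                         ∎

    y-formula : ∀ i → i ≤ n → y i ≡ (β - α) - γ * ⟦ i ⟧
    y-formula i i≤n = trans (arithmetic-progression n y γ y-step i i≤n) (cong (λ t → t - γ * ⟦ i ⟧) y₀)

    z-formula : ∀ i → i ≤ n → z i ≡ - β - γ * ⟦ i ⟧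
    z-formula i i≤n = trans (arithmetic-progression n z γ z-step i i≤n) (cong (λ t → t - γ * ⟦ i ⟧) (solve 1 (λ Z → Z := :- (:- Z)) refl (z 0)))

    x-formula : x i ≡ α + γ * ⟦ n ∸ i ⟧
    x-formula = begin
      x i
        ≡⟨ solve 3 (λ X Y Z → X := (X :+ Y :+ Z) :- Y :- Z) refl (x i) (y 0) (z (n ∸ i)) ⟩
      (x i + y 0 + z (n ∸ i)) - y 0 - z (n ∸ i)
        ≡⟨ cong₂ _-_ (cong₂ _-_ (relation i 0 (n ∸ i) (trans (cong (ℕ._+ (n ∸ i)) (ℕP.+-identityʳ i)) (ℕP.m+[n∸m]≡n i≤n)))
                                (y-formula 0 z≤n))
                     (z-formula (n ∸ i) (ℕP.m∸n≤m n i)) ⟩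
      0ℚ - ((β - α) - γ * ⟦ 0 ⟧) - (- β - γ * ⟦ n ∸ i ⟧)
        ≡⟨ solve 4 (λ A B G K → con 0ℚ :- ((B :- A) :- G :* con 0ℚ) :- (:- B :- G :* K) := A :+ G :* K) refl α β γ ⟦ n ∸ i ⟧ ⟩
      α + γ * ⟦ n ∸ i ⟧ ∎

  standardRelation-trivial : ∀ m {α β γ} x y z → StandardRelation (suc m) α β γ x y z →
                             x (suc m) ≡ 0ℚ → y (suc m) ≡ 0ℚ → z (suc m) ≡ 0ℚ →
                             ∀ i → i ≤ suc m → x i ≡ 0ℚ × y i ≡ 0ℚ × z i ≡ 0ℚ
  standardRelation-trivial m {α} {β} {γ} x y z rel xₙ≡0 yₙ≡0 zₙ≡0 i i≤n =
    trans (proj₁ (rel i i≤n)) (trans (cong₂ (λ p q → p + q * ⟦ suc m ∸ i ⟧) α≡0 γ≡0)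
      (solve 1 (λ K → con 0ℚ :+ con 0ℚ :* K := con 0ℚ) refl ⟦ suc m ∸ i ⟧)) ,
    trans (proj₁ (proj₂ (rel i i≤n))) (trans (cong₂ (λ p q → p - q * ⟦ i ⟧) (cong₂ _-_ β≡0 α≡0) γ≡0)
      (solve 1 (λ K → (con 0ℚ :- con 0ℚ) :- con 0ℚ :* K := con 0ℚ) refl ⟦ i ⟧)) ,
    trans (proj₂ (proj₂ (rel i i≤n))) (trans (cong₂ (λ p q → - p - q * ⟦ i ⟧) β≡0 γ≡0)
      (solve 1 (λ K → :- con 0ℚ :- con 0ℚ :* K := con 0ℚ) refl ⟦ i ⟧))
    where
    N : ℚ
    N = ⟦ suc m ⟧
    top : (x (suc m) ≡ α + γ * ⟦ m ∸ m ⟧) × (y (suc m) ≡ (β - α) - γ * N) × (z (suc m) ≡ - β - γ * N)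
    top = rel (suc m) ℕP.≤-refl
    α≡0 : α ≡ 0ℚ
    α≡0 = begin
      α                    ≡⟨ solve 2 (λ A G → A := A :+ G :* con 0ℚ) refl α γ ⟩
      α + γ * ⟦ 0 ⟧        ≡⟨ cong (λ k → α + γ * ⟦ k ⟧) (sym (ℕP.n∸n≡0 m)) ⟩
      α + γ * ⟦ m ∸ m ⟧    ≡⟨ trans (sym (proj₁ top)) xₙ≡0 ⟩
      0ℚ                   ∎
    β≡0 : β ≡ 0ℚ
    β≡0 = x+x≡0⇒x≡0 β (begin
      β + β                                          ≡⟨ solve 4 (λ A B G K → B :+ B := ((B :- A) :- G :* K) :- (:- B :- G :* K) :+ A) refl α β γ N ⟩
      ((β - α) - γ * N) - (- β - γ * N) + α          ≡⟨ cong₂ (λ p q → p - q + α) (trans (sym (proj₁ (proj₂ top))) yₙ≡0)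
                                                                               (trans (sym (proj₂ (proj₂ top))) zₙ≡0) ⟩
      0ℚ - 0ℚ + α                                    ≡⟨ trans (ℚP.+-identityˡ α) α≡0 ⟩
      0ℚ                                             ∎)
    γ≡0 : γ ≡ 0ℚ
    γ≡0 = x*⟦suc⟧≡0⇒x≡0 γ m (begin
      γ * N                  ≡⟨ solve 2 (λ G K → G :* K := :- (:- con 0ℚ :- G :* K)) refl γ N ⟩
      - (- 0ℚ - γ * N)       ≡⟨ cong (λ p → - (- p - γ * N)) (sym β≡0) ⟩
      - (- β - γ * N)        ≡⟨ cong -_ (trans (sym (proj₂ (proj₂ top))) zₙ≡0) ⟩
      0ℚ                     ∎)

module CoordinateSpans where
  open import Data.Rational using (ℚ; 0ℚ; _+_; _*_; _-_; -_)
  import Data.Rational.Properties as ℚP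
  open import Data.Rational.Solver using (module +-*-Solver)
  open +-*-Solver using (solve; _:+_; _:*_; _:-_; :-_; _:=_; con)
  open RationalFacts
  open Sums
  open Simplex
  open InnerProduct
  open Hexagons using (Separable)
  open LinearCombinations
  open Relations
  open ≡-Reasoning

  XYZ : ℕ → ℕ → List Vect
  XYZ n k = map (X n) (upTo k) ++ map (Y n) (upTo k) ++ map (Z n) (upTo k)

  truncate : ℕ → (ℕ → ℚ) → ℕ → ℚ
  truncate k x a = Σ< k (λ i → δ i a * x i)

  truncate-< : ∀ k x a → a < k → truncate k x a ≡ x a
  truncate-< k x a = Σ<-δ k a x

  truncate-≥ : ∀ k x a → k ≤ a → truncate k x a ≡ 0ℚ
  truncate-≥ k x a = Σ<-δ-outside k a x

  truncate-≤ : ∀ k x a → x k ≡ 0ℚ → a ≤ k → truncate k x a ≡ x a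
  truncate-≤ k x a xk≡0 a≤k with ℕP.m≤n⇒m<n∨m≡n a≤k
  ... | inj₁ a<k  = truncate-< k x a a<k
  ... | inj₂ refl = trans (truncate-≥ k x k ℕP.≤-refl) (sym xk≡0)

  ΣX-on-V3 : ∀ {n} k x a b c → a ℕ.+ b ℕ.+ c ≡ n → Σ< k (λ i → x i * X n i a b c) ≡ truncate k x a
  ΣX-on-V3 k x a b c eq = Σ<-cong k (λ i _ → trans (cong (x i *_) (trans (X-on-V3 i a b c eq) (δ-comm a i))) (ℚP.*-comm (x i) _))

  ΣY-on-V3 : ∀ {n} k y a b c → a ℕ.+ b ℕ.+ c ≡ n → Σ< k (λ i → y i * Y n i a b c) ≡ truncate k y b
  ΣY-on-V3 k y a b c eq = Σ<-cong k (λ i _ → trans (cong (y i *_) (trans (Y-on-V3 i a b c eq) (δ-comm b i))) (ℚP.*-comm (y i) _))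

  ΣZ-on-V3 : ∀ {n} k z a b c → a ℕ.+ b ℕ.+ c ≡ n → Σ< k (λ i → z i * Z n i a b c) ≡ truncate k z c
  ΣZ-on-V3 k z a b c eq = Σ<-cong k (λ i _ → trans (cong (z i *_) (trans (Z-on-V3 i a b c eq) (δ-comm c i))) (ℚP.*-comm (z i) _))

  combination : ∀ n k (x y z : ℕ → ℚ) → Fin (length (XYZ n k)) → ℚ
  combination n k x y z =
    append (map (X n) (upTo k)) _ (coefficientsOf (upTo k) (X n) x)
      (append (map (Y n) (upTo k)) _ (coefficientsOf (upTo k) (Y n) y) (coefficientsOf (upTo k) (Z n) z))

  combination-on-V3 : ∀ n k x y z a b c → a ℕ.+ b ℕ.+ c ≡ n →
    lincomb (XYZ n k) (combination n k x y z) a b c ≡ truncate k x a + (truncate k y b + truncate k z c)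
  combination-on-V3 n k x y z a b c eq =
    trans (lincomb-append (map (X n) (upTo k)) _ _ _ a b c)
      (cong₂ _+_ (on (X n) x (ΣX-on-V3 k x a b c eq))
        (trans (lincomb-append (map (Y n) (upTo k)) _ _ _ a b c)
          (cong₂ _+_ (on (Y n) y (ΣY-on-V3 k y a b c eq)) (on (Z n) z (ΣZ-on-V3 k z a b c eq)))))
    where
    on : ∀ (g : ℕ → Vect) w {t} → Σ< k (λ i → w i * g i a b c) ≡ t → lincomb (map g (upTo k)) (coefficientsOf (upTo k) g w) a b c ≡ t
    on g w Σ≡t = trans (lincomb-coefficientsOf (upTo k) g w a b c) (trans (ΣList-applyUpTo (λ i → i) k _) Σ≡t)

  module Parts (n k : ℕ) (c : Fin (length (XYZ n k)) → ℚ) where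
    Xs Ys Zs : List Vect
    Xs = map (X n) (upTo k)
    Ys = map (Y n) (upTo k)
    Zs = map (Z n) (upTo k)

    cX : Fin (length Xs) → ℚ
    cX = takeˡ Xs (Ys ++ Zs) c
    cYZ : Fin (length (Ys ++ Zs)) → ℚ
    cYZ = takeʳ Xs (Ys ++ Zs) c
    cY : Fin (length Ys) → ℚ
    cY = takeˡ Ys Zs cYZ
    cZ : Fin (length Zs) → ℚ
    cZ = takeʳ Ys Zs cYZ

    x y z : ℕ → ℚ
    x = coefficientAt (X n) (λ i → i) k cX
    y = coefficientAt (Y n) (λ i → i) k cY
    z = coefficientAt (Z n) (λ i → i) k cZ

    lincomb-on-V3 : ∀ a b d → a ℕ.+ b ℕ.+ d ≡ n → lincomb (XYZ n k) c a b d ≡ truncate k x a + (truncate k y b + truncate k z d)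
    lincomb-on-V3 a b d eq =
      trans (lincomb-++ Xs (Ys ++ Zs) c a b d)
        (cong₂ _+_ (trans (lincomb-coefficientAt (X n) (λ i → i) k cX a b d) (ΣX-on-V3 k x a b d eq))
          (trans (lincomb-++ Ys Zs cYZ a b d)
            (cong₂ _+_ (trans (lincomb-coefficientAt (Y n) (λ i → i) k cY a b d) (ΣY-on-V3 k y a b d eq))
                       (trans (lincomb-coefficientAt (Z n) (λ i → i) k cZ a b d) (ΣZ-on-V3 k z a b d eq)))))

    parts≡0⇒c≡0 : (∀ i → i < k → x i ≡ 0ℚ) → (∀ i → i < k → y i ≡ 0ℚ) → (∀ i → i < k → z i ≡ 0ℚ) → ∀ l → c l ≡ 0ℚ
    parts≡0⇒c≡0 x≡0 y≡0 z≡0 =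
      take≡0⇒coefficients≡0 Xs (Ys ++ Zs) c (coefficientAt≡0⇒coefficients≡0 (X n) (λ i → i) k cX x≡0)
        (take≡0⇒coefficients≡0 Ys Zs cYZ (coefficientAt≡0⇒coefficients≡0 (Y n) (λ i → i) k cY y≡0)
                                         (coefficientAt≡0⇒coefficients≡0 (Z n) (λ i → i) k cZ z≡0))

  XYZ-separable : ∀ n k → All (Separable n) (XYZ n k)
  XYZ-separable n k = AllP.++⁺ (AllP.map⁺ (AllP.applyUpTo⁺₂ (λ i → i) k X-separable))
    (AllP.++⁺ (AllP.map⁺ (AllP.applyUpTo⁺₂ (λ i → i) k Y-separable)) (AllP.map⁺ (AllP.applyUpTo⁺₂ (λ i → i) k Z-separable)))
    where
    X-separable : ∀ i → Separable n (X n i)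
    X-separable i = (λ a → δ a i) , (λ _ → 0ℚ) , (λ _ → 0ℚ) ,
      λ a b c eq → trans (X-on-V3 i a b c eq) (sym (trans (ℚP.+-identityʳ _) (ℚP.+-identityʳ _)))
    Y-separable : ∀ i → Separable n (Y n i)
    Y-separable i = (λ _ → 0ℚ) , (λ b → δ b i) , (λ _ → 0ℚ) ,
      λ a b c eq → trans (Y-on-V3 i a b c eq) (sym (trans (ℚP.+-identityʳ _) (ℚP.+-identityˡ _)))
    Z-separable : ∀ i → Separable n (Z n i)
    Z-separable i = (λ _ → 0ℚ) , (λ _ → 0ℚ) , (λ c → δ c i) ,
      λ a b c eq → trans (Z-on-V3 i a b c eq) (sym (ℚP.+-identityˡ _))

  inSpan-XYZ⇒separable : ∀ n k v → InSpan n (XYZ n k) v → Separable n v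
  inSpan-XYZ⇒separable n k v (c , v≈) = truncate k x , truncate k y , truncate k z ,
    λ a b d eq → trans (v≈ a b d eq) (trans (lincomb-on-V3 a b d eq) (sym (ℚP.+-assoc (truncate k x a) (truncate k y b) (truncate k z d))))
    where open Parts n k c

  separable⇒inSpan-Bs : ∀ n v → Separable n v → InSpan n (Bs n) v
  separable⇒inSpan-Bs n v (x , y , z , v≈) = combination n (suc n) x y z , λ a b c eq →
    let (a≤n , b≤n , c≤n) = V3-bounds a b c eq in begin
    v a b c                                                                    ≡⟨ v≈ a b c eq ⟩
    x a + y b + z c                                                            ≡⟨ ℚP.+-assoc (x a) (y b) (z c) ⟩
    x a + (y b + z c)                                                          ≡⟨ sym (cong₂ _+_ (truncate-< _ x a (s≤s a≤n))
                                                                                    (cong₂ _+_ (truncate-< _ y b (s≤s b≤n)) (truncate-< _ z c (s≤s c≤n)))) ⟩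
    truncate (suc n) x a + (truncate (suc n) y b + truncate (suc n) z c)      ≡⟨ sym (combination-on-V3 n (suc n) x y z a b c eq) ⟩
    lincomb (Bs n) (combination n (suc n) x y z) a b c                         ∎

  separable⇒inSpan-B's : ∀ m v → Separable (suc m) v → InSpan (suc m) (B's (suc m)) v
  separable⇒inSpan-B's m v (x , y , z , v≈) = combination n n x′ y′ z′ , λ a b c eq →
    let (a≤n , b≤n , c≤n) = V3-bounds a b c eq in begin
    v a b c                                                              ≡⟨ v≈ a b c eq ⟩
    x a + y b + z c                                                      ≡⟨ shift a b c eq ⟩
    x′ a + (y′ b + z′ c)                                                 ≡⟨ sym (cong₂ _+_ (truncate-≤ n x′ a x′ₙ≡0 a≤n)
                                                                              (cong₂ _+_ (truncate-≤ n y′ b y′ₙ≡0 b≤n) (truncate-≤ n z′ c z′ₙ≡0 c≤n))) ⟩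
    truncate n x′ a + (truncate n y′ b + truncate n z′ c)                ≡⟨ sym (combination-on-V3 n n x′ y′ z′ a b c eq) ⟩
    lincomb (B's n) (combination n n x′ y′ z′) a b c                     ∎
    where
    n : ℕ
    n = suc m
    -- adding a standard relation keeps the values on V(3,n); α, β, γ make the coefficients vanish at n
    h γ α β : ℚ
    h = ½ * (x n + y n + z n)
    γ = proj₁ (∃-*⟦suc⟧≡ h m)
    α = - x n
    β = z n - h
    γN≡h : γ * ⟦ n ⟧ ≡ h
    γN≡h = proj₂ (∃-*⟦suc⟧≡ h m)

    x′ y′ z′ : ℕ → ℚ
    x′ i = x i + (α + γ * ⟦ n ∸ i ⟧)
    y′ i = y i + ((β - α) - γ * ⟦ i ⟧)
    z′ i = z i + (- β - γ * ⟦ i ⟧)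

    shift : ∀ a b c → a ℕ.+ b ℕ.+ c ≡ n → x a + y b + z c ≡ x′ a + (y′ b + z′ c)
    shift a b c eq = begin
      x a + y b + z c
        ≡⟨ sym (ℚP.+-identityʳ _) ⟩
      x a + y b + z c + 0ℚ
        ≡⟨ cong (x a + y b + z c +_) (sym (standardRelation-vanishes α β γ a b c eq)) ⟩
      x a + y b + z c + ((α + γ * ⟦ n ∸ a ⟧) + ((β - α) - γ * ⟦ b ⟧) + (- β - γ * ⟦ c ⟧))
        ≡⟨ solve 6 (λ X Y Z R S T → X :+ Y :+ Z :+ (R :+ S :+ T) := X :+ R :+ ((Y :+ S) :+ (Z :+ T))) refl
             (x a) (y b) (z c) (α + γ * ⟦ n ∸ a ⟧) ((β - α) - γ * ⟦ b ⟧) (- β - γ * ⟦ c ⟧) ⟩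
      x′ a + (y′ b + z′ c) ∎

    x′ₙ≡0 : x′ n ≡ 0ℚ
    x′ₙ≡0 = begin
      x n + (- x n + γ * ⟦ m ∸ m ⟧)  ≡⟨ cong (λ k → x n + (- x n + γ * ⟦ k ⟧)) (ℕP.n∸n≡0 m) ⟩
      x n + (- x n + γ * ⟦ 0 ⟧)      ≡⟨ solve 2 (λ X G → X :+ (:- X :+ G :* con 0ℚ) := con 0ℚ) refl (x n) γ ⟩
      0ℚ                             ∎
    y′ₙ≡0 : y′ n ≡ 0ℚ
    y′ₙ≡0 = begin
      y n + ((z n - h - - x n) - γ * ⟦ n ⟧)   ≡⟨ cong (λ t → y n + ((z n - h - - x n) - t)) γN≡h ⟩
      y n + ((z n - h - - x n) - h)           ≡⟨ solve 4 (λ X Y Z H → Y :+ ((Z :- H :- :- X) :- H) := (X :+ Y :+ Z) :- (H :+ H)) refl (x n) (y n) (z n) h ⟩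
      (x n + y n + z n) - (h + h)             ≡⟨ cong (λ t → (x n + y n + z n) - t) (½*x+½*x≡x (x n + y n + z n)) ⟩
      (x n + y n + z n) - (x n + y n + z n)   ≡⟨ ℚP.+-inverseʳ (x n + y n + z n) ⟩
      0ℚ                                      ∎
    z′ₙ≡0 : z′ n ≡ 0ℚ
    z′ₙ≡0 = begin
      z n + (- (z n - h) - γ * ⟦ n ⟧)  ≡⟨ cong (λ t → z n + (- (z n - h) - t)) γN≡h ⟩
      z n + (- (z n - h) - h)          ≡⟨ solve 2 (λ Z H → Z :+ (:- (Z :- H) :- H) := con 0ℚ) refl (z n) h ⟩
      0ℚ                               ∎

  B's-independent : ∀ m → LinIndep (suc m) (B's (suc m))
  B's-independent m c lincomb≈0 = parts≡0⇒c≡0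
    (λ i i<n → trans (sym (truncate-< n x i i<n)) (proj₁ (trivial i (ℕP.<⇒≤ i<n))))
    (λ i i<n → trans (sym (truncate-< n y i i<n)) (proj₁ (proj₂ (trivial i (ℕP.<⇒≤ i<n)))))
    (λ i i<n → trans (sym (truncate-< n z i i<n)) (proj₂ (proj₂ (trivial i (ℕP.<⇒≤ i<n)))))
    where
    n : ℕ
    n = suc m
    open Parts n n c
    relation : ∀ a b d → a ℕ.+ b ℕ.+ d ≡ n → truncate n x a + truncate n y b + truncate n z d ≡ 0ℚ
    relation a b d eq = trans (ℚP.+-assoc (truncate n x a) _ _) (trans (sym (lincomb-on-V3 a b d eq)) (lincomb≈0 a b d eq))
    trivial : ∀ i → i ≤ n → truncate n x i ≡ 0ℚ × truncate n y i ≡ 0ℚ × truncate n z i ≡ 0ℚ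
    trivial = standardRelation-trivial m {truncate n x n} {(- truncate n z 0)} {truncate n z 0 - truncate n z 1}
      (truncate n x) (truncate n y) (truncate n z)
      (relation⇒standardRelation m (truncate n x) (truncate n y) (truncate n z) relation)
      (truncate-≥ n x n ℕP.≤-refl) (truncate-≥ n y n ℕP.≤-refl) (truncate-≥ n z n ℕP.≤-refl)

  relVec-on-V3 : ∀ n x y z a b c → a ℕ.+ b ℕ.+ c ≡ n → relVec n x y z a b c ≡ x a + y b + z c
  relVec-on-V3 n x y z a b c eq =
    let (a≤n , b≤n , c≤n) = V3-bounds a b c eq in begin
    relVec n x y z a b c
      ≡⟨ Σ≤≡Σ< n _ ⟩
    Σ< (suc n) (λ i → x i * X n i a b c + y i * Y n i a b c + z i * Z n i a b c)
      ≡⟨ Σ<-+ (suc n) (λ i → x i * X n i a b c + y i * Y n i a b c) (λ i → z i * Z n i a b c) ⟩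
    Σ< (suc n) (λ i → x i * X n i a b c + y i * Y n i a b c) + Σ< (suc n) (λ i → z i * Z n i a b c)
      ≡⟨ cong (_+ Σ< (suc n) (λ i → z i * Z n i a b c)) (Σ<-+ (suc n) (λ i → x i * X n i a b c) (λ i → y i * Y n i a b c)) ⟩
    Σ< (suc n) (λ i → x i * X n i a b c) + Σ< (suc n) (λ i → y i * Y n i a b c) + Σ< (suc n) (λ i → z i * Z n i a b c)
      ≡⟨ cong₂ _+_ (cong₂ _+_ (trans (ΣX-on-V3 (suc n) x a b c eq) (truncate-< (suc n) x a (s≤s a≤n)))
                              (trans (ΣY-on-V3 (suc n) y a b c eq) (truncate-< (suc n) y b (s≤s b≤n))))
                   (trans (ΣZ-on-V3 (suc n) z a b c eq) (truncate-< (suc n) z c (s≤s c≤n))) ⟩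
    x a + y b + z c ∎

  relVec≈0⇔standardRelation : ∀ m x y z →
    relVec (suc m) x y z ≈[ suc m ] (λ _ _ _ → 0ℚ) ⇔ (∃ λ α → ∃ λ β → ∃ λ γ → StandardRelation (suc m) α β γ x y z)
  relVec≈0⇔standardRelation m x y z = mk⇔
    (λ relVec≈0 → x (suc m) , - z 0 , z 0 - z 1 , relation⇒standardRelation m x y z
      (λ a b c eq → trans (sym (relVec-on-V3 (suc m) x y z a b c eq)) (relVec≈0 a b c eq)))
    (λ { (α , β , γ , standard) a b c eq →
      let (a≤n , b≤n , c≤n) = V3-bounds a b c eq in begin
      relVec (suc m) x y z a b c
        ≡⟨ relVec-on-V3 (suc m) x y z a b c eq ⟩
      x a + y b + z c
        ≡⟨ cong₂ _+_ (cong₂ _+_ (proj₁ (standard a a≤n)) (proj₁ (proj₂ (standard b b≤n)))) (proj₂ (proj₂ (standard c c≤n))) ⟩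
      (α + γ * ⟦ suc m ∸ a ⟧) + ((β - α) - γ * ⟦ b ⟧) + (- β - γ * ⟦ c ⟧)
        ≡⟨ standardRelation-vanishes α β γ a b c eq ⟩
      0ℚ ∎ })

module HexagonVectors where
  open import Data.Rational using (ℚ; 0ℚ; 1ℚ; _+_; _*_; _-_; -_)
  import Data.Rational.Properties as ℚP
  open RationalFacts
  open Sums
  open Simplex
  open InnerProduct
  open Hexagons
  open LinearCombinations
  open CoordinateSpans using (XYZ-separable; separable⇒inSpan-Bs; inSpan-XYZ⇒separable)

  hexagonVector : Triple → Vect
  hexagonVector (a , b , c) = H a b c

  innerTriples : ℕ → List Triple
  innerTriples n = filter (inner? n) (V3 n)

  inner-centre : ∀ {n} a b c → 3 ℕ.+ (a ℕ.+ b ℕ.+ c) ≡ n → Inner n (suc a , suc b , suc c)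
  inner-centre {n} a b c eq = (s≤s z≤n , below a a≤S) , (s≤s z≤n , below b b≤S) , (s≤s z≤n , below c c≤S)
    where
    S : ℕ
    S = a ℕ.+ b ℕ.+ c
    below : ∀ x → x ≤ S → suc x < n
    below x x≤S = subst (suc x <_) eq (s≤s (s≤s (ℕP.m≤n⇒m≤1+n x≤S)))
    a≤S : a ≤ S
    a≤S = proj₁ (V3-bounds a b c refl)
    b≤S : b ≤ S
    b≤S = proj₁ (proj₂ (V3-bounds a b c refl))
    c≤S : c ≤ S
    c≤S = proj₂ (proj₂ (V3-bounds a b c refl))

  inner-sum : ∀ {n} a b c → suc a ℕ.+ suc b ℕ.+ suc c ≡ n → 3 ℕ.+ (a ℕ.+ b ℕ.+ c) ≡ n
  inner-sum a b c eq = trans (sym (vertex-on-V3 1 1 1 {a} {b} {c} refl refl)) eq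

  inner-sum⁻¹ : ∀ {n} a b c → 3 ℕ.+ (a ℕ.+ b ℕ.+ c) ≡ n → suc a ℕ.+ suc b ℕ.+ suc c ≡ n
  inner-sum⁻¹ a b c eq = vertex-on-V3 1 1 1 refl eq

  ⊥Hs⇔hexagons : ∀ n v → All (λ h → dot n v h ≡ 0ℚ) (Hs n) ⇔ (∀ a b c → 3 ℕ.+ (a ℕ.+ b ℕ.+ c) ≡ n → hexagon v a b c ≡ 0ℚ)
  ⊥Hs⇔hexagons n v = mk⇔ to from
    where
    Orthogonal : Triple → Set
    Orthogonal t = dot n v (hexagonVector t) ≡ 0ℚ
    to : All (λ h → dot n v h ≡ 0ℚ) (Hs n) → ∀ a b c → 3 ℕ.+ (a ℕ.+ b ℕ.+ c) ≡ n → hexagon v a b c ≡ 0ℚ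
    to ⊥ a b c eq = trans (sym (dot-H n v a b c eq))
      (All-V3⁻ n (λ t → Inner n t → Orthogonal t) (filter-All⁻ (inner? n) (V3 n) (AllP.map⁻ ⊥))
        (suc a) (suc b) (suc c) (inner-sum⁻¹ a b c eq) (inner-centre a b c eq))
    from : (∀ a b c → 3 ℕ.+ (a ℕ.+ b ℕ.+ c) ≡ n → hexagon v a b c ≡ 0ℚ) → All (λ h → dot n v h ≡ 0ℚ) (Hs n)
    from hexagon≡0 = AllP.map⁺ (filter-All⁺ (inner? n) (V3 n) (All-V3⁺ n (λ t → Inner n t → Orthogonal t) orthogonal))
      where
      orthogonal : ∀ a b c → a ℕ.+ b ℕ.+ c ≡ n → Inner n (a , b , c) → Orthogonal (a , b , c)
      orthogonal zero    b       c       eq ((() , _) , _)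
      orthogonal (suc a) zero    c       eq (_ , (() , _) , _)
      orthogonal (suc a) (suc b) zero    eq (_ , _ , (() , _))
      orthogonal (suc a) (suc b) (suc c) eq _ = trans (dot-H n v a b c (inner-sum a b c eq)) (hexagon≡0 a b c (inner-sum a b c eq))

  e-vanishes₁ : ∀ x y z q₁ q₂ q₃ → q₁ ≢ x → e x y z q₁ q₂ q₃ ≡ 0ℚ
  e-vanishes₁ x y z q₁ q₂ q₃ q₁≢x = begin
    δ q₁ x * δ q₂ y * δ q₃ z   ≡⟨ cong (λ d → d * δ q₂ y * δ q₃ z) (δ-≢ q₁≢x) ⟩
    0ℚ * δ q₂ y * δ q₃ z       ≡⟨ cong (_* δ q₃ z) (ℚP.*-zeroˡ (δ q₂ y)) ⟩
    0ℚ * δ q₃ z                ≡⟨ ℚP.*-zeroˡ (δ q₃ z) ⟩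
    0ℚ                         ∎
    where open ≡-Reasoning

  e-vanishes₃ : ∀ x y z q₁ q₂ q₃ → q₃ ≢ z → e x y z q₁ q₂ q₃ ≡ 0ℚ
  e-vanishes₃ x y z q₁ q₂ q₃ q₃≢z = trans (cong (δ q₁ x * δ q₂ y *_) (δ-≢ q₃≢z)) (ℚP.*-zeroʳ (δ q₁ x * δ q₂ y))

  alternating-zero : ∀ {p₁ p₂ p₃ p₄ p₅ p₆ : ℚ} → p₁ ≡ 0ℚ → p₂ ≡ 0ℚ → p₃ ≡ 0ℚ → p₄ ≡ 0ℚ → p₅ ≡ 0ℚ → p₆ ≡ 0ℚ →
                     p₁ - p₂ + p₃ - p₄ + p₅ - p₆ ≡ 0ℚ
  alternating-zero refl refl refl refl refl refl = refl

  H-above : ∀ a b c q₁ q₂ q₃ → suc (suc c) < q₃ → H (suc a) (suc b) (suc c) q₁ q₂ q₃ ≡ 0ℚ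
  H-above a b c q₁ q₂ q₃ c+2<q₃ = alternating-zero
    (e-vanishes₃ a (suc b) (suc (suc c)) q₁ q₂ q₃ (above ℕP.≤-refl))
    (e-vanishes₃ (suc a) b (suc (suc c)) q₁ q₂ q₃ (above ℕP.≤-refl))
    (e-vanishes₃ (suc (suc a)) b (suc c) q₁ q₂ q₃ (above (ℕP.n≤1+n _)))
    (e-vanishes₃ (suc (suc a)) (suc b) c q₁ q₂ q₃ (above c≤c+2))
    (e-vanishes₃ (suc a) (suc (suc b)) c q₁ q₂ q₃ (above c≤c+2))
    (e-vanishes₃ a (suc (suc b)) (suc c) q₁ q₂ q₃ (above (ℕP.n≤1+n _)))
    where
    above : ∀ {k} → k ≤ suc (suc c) → q₃ ≢ k
    above k≤ = ℕP.>⇒≢ (ℕP.≤-<-trans k≤ c+2<q₃)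
    c≤c+2 : c ≤ suc (suc c)
    c≤c+2 = ℕP.m≤n⇒m≤1+n (ℕP.n≤1+n c)

  H-beside : ∀ a b c q₁ q₂ → suc a < q₁ → H (suc a) (suc b) (suc c) q₁ q₂ (suc (suc c)) ≡ 0ℚ
  H-beside a b c q₁ q₂ a+1<q₁ = alternating-zero
    (e-vanishes₁ a (suc b) (suc (suc c)) q₁ q₂ c+2 (ℕP.>⇒≢ (ℕP.<-trans (ℕP.n<1+n a) a+1<q₁)))
    (e-vanishes₁ (suc a) b (suc (suc c)) q₁ q₂ c+2 (ℕP.>⇒≢ a+1<q₁))
    (e-vanishes₃ (suc (suc a)) b (suc c) q₁ q₂ c+2 (ℕP.>⇒≢ (ℕP.n<1+n (suc c))))
    (e-vanishes₃ (suc (suc a)) (suc b) c q₁ q₂ c+2 (ℕP.>⇒≢ c<c+2))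
    (e-vanishes₃ (suc a) (suc (suc b)) c q₁ q₂ c+2 (ℕP.>⇒≢ c<c+2))
    (e-vanishes₃ a (suc (suc b)) (suc c) q₁ q₂ c+2 (ℕP.>⇒≢ (ℕP.n<1+n (suc c))))
    where
    c+2 : ℕ
    c+2 = suc (suc c)
    c<c+2 : c < suc (suc c)
    c<c+2 = ℕP.<-trans (ℕP.n<1+n c) (ℕP.n<1+n (suc c))

  H-pivot : ∀ a b c → H (suc a) (suc b) (suc c) (suc a) b (suc (suc c)) ≡ - 1ℚ
  H-pivot a b c = begin
    H (suc a) (suc b) (suc c) (suc a) b (suc (suc c))
      ≡⟨ cong₂ _-_ (cong₂ _+_ (cong₂ _-_ (cong₂ _+_ (cong₂ _-_
           (e-vanishes₁ a (suc b) (suc (suc c)) (suc a) b (suc (suc c)) (ℕP.>⇒≢ (ℕP.n<1+n a)))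
           (cong₂ _*_ (cong₂ _*_ (δ-refl (suc a)) (δ-refl b)) (δ-refl (suc (suc c)))))
           (e-vanishes₃ (suc (suc a)) b (suc c) (suc a) b (suc (suc c)) (ℕP.>⇒≢ (ℕP.n<1+n (suc c)))))
           (e-vanishes₃ (suc (suc a)) (suc b) c (suc a) b (suc (suc c)) (ℕP.>⇒≢ c<c+2)))
           (e-vanishes₃ (suc a) (suc (suc b)) c (suc a) b (suc (suc c)) (ℕP.>⇒≢ c<c+2)))
           (e-vanishes₃ a (suc (suc b)) (suc c) (suc a) b (suc (suc c)) (ℕP.>⇒≢ (ℕP.n<1+n (suc c)))) ⟩
    0ℚ - 1ℚ + 0ℚ - 0ℚ + 0ℚ - 0ℚ
      ≡⟨⟩
    - 1ℚ ∎
    where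
    open ≡-Reasoning
    c<c+2 : c < suc (suc c)
    c<c+2 = ℕP.<-trans (ℕP.n<1+n c) (ℕP.n<1+n (suc c))

  -- The pivot (a, b, c), a ≥ 1, c ≥ 2, is cleared by the hexagon centred at (a, b + 1, c − 1); pivots
  -- are taken by decreasing c, and within a level by decreasing a.
  module Elimination (n : ℕ) (v : Vect) where
    open import Data.Rational.Solver using (module +-*-Solver)
    open +-*-Solver using (solve; _:+_; _:*_; _:-_; :-_; _:=_; con)
    open ≡-Reasoning

    combination : (Triple → ℚ) → Vect
    combination κ a b c = ΣList (innerTriples n) (λ t → κ t * hexagonVector t a b c)

    residual : (Triple → ℚ) → Vect
    residual κ = v ⊖ combination κ

    update : (Triple → ℚ) → ℚ → ℕ → ℕ → ℕ → Triple → ℚ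
    update κ s a b c (p , q , r) = κ (p , q , r) - s * e (suc a) (suc b) (suc c) p q r

    residual-update : ∀ κ s a b c → 3 ℕ.+ (a ℕ.+ b ℕ.+ c) ≡ n → ∀ p q r →
                      residual (update κ s a b c) p q r ≡ residual κ p q r + s * H (suc a) (suc b) (suc c) p q r
    residual-update κ s a b c eq p q r = begin
      v p q r - ΣList (innerTriples n) (λ t → update κ s a b c t * hexagonVector t p q r)
        ≡⟨ cong (_-_ (v p q r)) (ΣList-cong (innerTriples n) (λ { (i , j , k) →
             solve 4 (λ K S E G → (K :- S :* E) :* G := K :* G :- S :* (E :* G)) refl
               (κ (i , j , k)) s (e (suc a) (suc b) (suc c) i j k) (H i j k p q r) })) ⟩
      v p q r - ΣList (innerTriples n) (λ t → κ t * hexagonVector t p q r - s * centre t)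
        ≡⟨ cong (_-_ (v p q r)) (trans (ΣList-- (innerTriples n) _ _) (cong (_-_ (combination κ p q r)) (ΣList-*ˡ (innerTriples n) s centre))) ⟩
      v p q r - (combination κ p q r - s * ΣList (innerTriples n) centre)
        ≡⟨ cong (λ t → v p q r - (combination κ p q r - s * t)) centre-sum ⟩
      v p q r - (combination κ p q r - s * H (suc a) (suc b) (suc c) p q r)
        ≡⟨ solve 3 (λ V C G → V :- (C :- G) := V :- C :+ G) refl (v p q r) (combination κ p q r) (s * H (suc a) (suc b) (suc c) p q r) ⟩
      residual κ p q r + s * H (suc a) (suc b) (suc c) p q r ∎
      where
      centre : Triple → ℚ
      centre (i , j , k) = e (suc a) (suc b) (suc c) i j k * H i j k p q r
      centre-sum : ΣList (innerTriples n) centre ≡ H (suc a) (suc b) (suc c) p q r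
      centre-sum = begin
        ΣList (innerTriples n) centre
          ≡⟨ ΣList-filter (inner? n) (V3 n) centre ⟩
        ΣList (V3 n) (λ t → 𝟙 (inner? n t) * centre t)
          ≡⟨ ΣList-cong (V3 n) (λ { (i , j , k) → solve 3 (λ I E G → I :* (E :* G) := I :* G :* E) refl
               (𝟙 (inner? n (i , j , k))) (e (suc a) (suc b) (suc c) i j k) (H i j k p q r) }) ⟩
        ΣList (V3 n) (λ { (i , j , k) → 𝟙 (inner? n (i , j , k)) * H i j k p q r * e (suc a) (suc b) (suc c) i j k })
          ≡⟨ ΣV3-δ n (suc a) (suc b) (suc c) (λ t → 𝟙 (inner? n t) * hexagonVector t p q r) (inner-sum⁻¹ a b c eq) ⟩
        𝟙 (inner? n (suc a , suc b , suc c)) * H (suc a) (suc b) (suc c) p q r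
          ≡⟨ trans (cong (_* H (suc a) (suc b) (suc c) p q r) (𝟙-yes (inner? n _) (inner-centre a b c eq))) (ℚP.*-identityˡ _) ⟩
        H (suc a) (suc b) (suc c) p q r ∎

    ClearedAbove : (Triple → ℚ) → ℕ → Set
    ClearedAbove κ C = ∀ a b c → a ℕ.+ b ℕ.+ c ≡ n → C ≤ c → 1 ≤ a → 2 ≤ c → residual κ a b c ≡ 0ℚ

    ClearedRow : (Triple → ℚ) → ℕ → ℕ → Set
    ClearedRow κ C A = ∀ a b → a ℕ.+ b ℕ.+ C ≡ n → A ≤ a → 1 ≤ a → residual κ a b C ≡ 0ℚ

    PartlyCleared : ℕ → ℕ → Set
    PartlyCleared C A = ∃ λ κ → ClearedAbove κ (suc C) × ClearedRow κ C A

    middle-unique : ∀ {a b b′ c} → a ℕ.+ b ℕ.+ c ≡ n → a ℕ.+ b′ ℕ.+ c ≡ n → b ≡ b′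
    middle-unique {a} {b} {b′} {c} eq eq′ =
      ℕP.+-cancelˡ-≡ a b b′ (ℕP.+-cancelʳ-≡ c (a ℕ.+ b) (a ℕ.+ b′) (trans eq (sym eq′)))

    -- besides the pivot (A + 1, B, C), the hexagon only changes lower levels and the point (A, B + 1, C)
    clear-pivot : ∀ C′ A → PartlyCleared (2 ℕ.+ C′) (2 ℕ.+ A) → PartlyCleared (2 ℕ.+ C′) (suc A)
    clear-pivot C′ A (κ , above , row) with suc A ℕ.+ C ℕP.≤? n
      where
      C : ℕ
      C = 2 ℕ.+ C′
    ... | no A+1+C≰n = κ , above , row′
      where
      row′ : ClearedRow κ (2 ℕ.+ C′) (suc A)
      row′ a b eq A+1≤a 1≤a with ℕP.m≤n⇒m<n∨m≡n A+1≤a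
      ... | inj₁ A+1<a = row a b eq A+1<a 1≤a
      ... | inj₂ refl  = ⊥-elim (A+1+C≰n (subst (suc A ℕ.+ (2 ℕ.+ C′) ≤_) eq (ℕP.+-monoˡ-≤ (2 ℕ.+ C′) (ℕP.m≤m+n (suc A) b))))
    ... | yes A+1+C≤n = κ′ , above′ , row′
      where
      C B : ℕ
      C = 2 ℕ.+ C′
      B = n ∸ (suc A ℕ.+ C)
      pivot : suc A ℕ.+ B ℕ.+ C ≡ n
      pivot = trans (cong (ℕ._+ C) (ℕP.+-comm (suc A) B)) (trans (ℕP.+-assoc B (suc A) C) (ℕP.m∸n+n≡m A+1+C≤n))
      centre : 3 ℕ.+ (A ℕ.+ B ℕ.+ C′) ≡ n
      centre = trans (sym (vertex-on-V3 1 0 2 {A} {B} {C′} refl refl)) pivot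
      s : ℚ
      s = residual κ (suc A) B C
      κ′ : Triple → ℚ
      κ′ = update κ s A B C′
      unchanged : ∀ {p q r} → residual κ p q r ≡ 0ℚ → H (suc A) (suc B) (suc C′) p q r ≡ 0ℚ → residual κ′ p q r ≡ 0ℚ
      unchanged {p} {q} {r} res≡0 H≡0 = begin
        residual κ′ p q r                                   ≡⟨ residual-update κ s A B C′ centre p q r ⟩
        residual κ p q r + s * H (suc A) (suc B) (suc C′) p q r ≡⟨ cong₂ (λ x y → x + s * y) res≡0 H≡0 ⟩
        0ℚ + s * 0ℚ                                         ≡⟨ solve 1 (λ s → con 0ℚ :+ s :* con 0ℚ := con 0ℚ) refl s ⟩
        0ℚ                                                  ∎
      above′ : ClearedAbove κ′ (suc C)
      above′ a b c eq C<c 1≤a 2≤c = unchanged (above a b c eq C<c 1≤a 2≤c) (H-above A B C′ a b c C<c)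
      row′ : ClearedRow κ′ C (suc A)
      row′ a b eq A+1≤a 1≤a with ℕP.m≤n⇒m<n∨m≡n A+1≤a
      ... | inj₁ A+1<a = unchanged (row a b eq A+1<a 1≤a) (H-beside A B C′ a b A+1<a)
      ... | inj₂ refl with middle-unique {suc A} {b} {B} {C} eq pivot
      ... | refl = begin
        residual κ′ (suc A) B C                 ≡⟨ residual-update κ s A B C′ centre (suc A) B C ⟩
        s + s * H (suc A) (suc B) (suc C′) (suc A) B C ≡⟨ cong (λ h → s + s * h) (H-pivot A B C′) ⟩
        s + s * - 1ℚ                            ≡⟨ solve 1 (λ s → s :+ s :* (:- con 1ℚ) := con 0ℚ) refl s ⟩
        0ℚ                                      ∎

    clear-column : ∀ C′ A → PartlyCleared (2 ℕ.+ C′) (suc A) → PartlyCleared (2 ℕ.+ C′) A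
    clear-column C′ zero    (κ , above , row) = κ , above , λ a b eq _ 1≤a → row a b eq 1≤a 1≤a
    clear-column C′ (suc A) = clear-pivot C′ A

    clear-level : ∀ C → (∃ λ κ → ClearedAbove κ (suc C)) → ∃ λ κ → ClearedAbove κ C
    clear-level zero          (κ , above) = κ , λ a b c eq _ 1≤a 2≤c → above a b c eq (ℕP.≤-trans (s≤s z≤n) 2≤c) 1≤a 2≤c
    clear-level (suc zero)    (κ , above) = κ , λ a b c eq _ 1≤a 2≤c → above a b c eq 2≤c 1≤a 2≤c
    clear-level (suc (suc C′)) (κ₀ , above₀) with descend {PartlyCleared C} (suc n) (κ₀ , above₀ , beyond)
                                                    (clear-column C′)
      where
      C : ℕ
      C = suc (suc C′)
      beyond : ClearedRow κ₀ C (suc n)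
      beyond a b eq n<a _ = ⊥-elim (ℕP.<⇒≱ n<a (proj₁ (V3-bounds a b C eq)))
    ... | (κ , above , row) = κ , cleared
      where
      cleared : ClearedAbove κ (suc (suc C′))
      cleared a b c eq C≤c 1≤a 2≤c with ℕP.m≤n⇒m<n∨m≡n C≤c
      ... | inj₁ C<c = above a b c eq C<c 1≤a 2≤c
      ... | inj₂ refl = row a b eq z≤n 1≤a

    eliminate : ∃ λ κ → ∀ a b c → a ℕ.+ b ℕ.+ c ≡ n → 1 ≤ a → 2 ≤ c → residual κ a b c ≡ 0ℚ
    eliminate = Data.Product.map₂ (λ cleared a b c eq → cleared a b c eq z≤n)
      (descend {λ C → ∃ λ κ → ClearedAbove κ C} (suc n) ((λ _ → 0ℚ) , nothing-above) clear-level)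
      where
      nothing-above : ClearedAbove (λ _ → 0ℚ) (suc n)
      nothing-above a b c eq n<c _ _ = ⊥-elim (ℕP.<⇒≱ n<c (proj₂ (proj₂ (V3-bounds a b c eq))))

  frame-or-pivot : ∀ a c → Frame a c ⊎ (1 ≤ a × 2 ≤ c)
  frame-or-pivot a       zero          = inj₁ (inj₁ z≤n)
  frame-or-pivot a       (suc zero)    = inj₁ (inj₁ (s≤s z≤n))
  frame-or-pivot zero    (suc (suc c)) = inj₁ (inj₂ refl)
  frame-or-pivot (suc a) (suc (suc c)) = inj₂ (s≤s z≤n , s≤s (s≤s z≤n))

  separable⇒⊥Hs : ∀ n u → Separable n u → All (λ h → dot n u h ≡ 0ℚ) (Hs n)
  separable⇒⊥Hs n u sep = Equivalence.from (⊥Hs⇔hexagons n u) (hexagon-separable u sep)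

  ⊥Bs⇒inSpan-Hs : ∀ n v → All (λ w → dot n v w ≡ 0ℚ) (Bs n) → InSpan n (Hs n) v
  ⊥Bs⇒inSpan-Hs n v v⊥Bs = cH , v≈combination
    where
    open Elimination n v
    open ≡-Reasoning
    κ : Triple → ℚ
    κ = proj₁ eliminate
    cH : Fin (length (Hs n)) → ℚ
    cH = coefficientsOf (innerTriples n) hexagonVector κ
    r : Vect
    r = residual κ
    combination≈lincomb : combination κ ≈[ n ] lincomb (Hs n) cH
    combination≈lincomb a b c _ = sym (lincomb-coefficientsOf (innerTriples n) hexagonVector κ a b c)
    r⊥Bs : All (λ w → dot n r w ≡ 0ℚ) (Bs n)
    r⊥Bs = All.zipWith (λ { {w} (vw≡0 , w-separable) → begin
      dot n r w                                  ≡⟨ dot-⊖ˡ n v (combination κ) w ⟩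
      dot n v w - dot n (combination κ) w        ≡⟨ cong₂ _-_ vw≡0 (trans (dot-congˡ n w combination≈lincomb)
                                                      (trans (dot-comm n (lincomb (Hs n) cH) w) (dot-lincombʳ n w (Hs n) cH (separable⇒⊥Hs n w w-separable)))) ⟩
      0ℚ - 0ℚ                                    ≡⟨⟩
      0ℚ                                         ∎ }) (v⊥Bs , XYZ-separable n (suc n))

    open FrameExtension n r
    -- r vanishes off the frame and the extension agrees with r on it, so ⟨r, extension⟩ = ⟨r, r⟩
    r·extension≡r·r : dot n r extension ≡ ΣList (V3 n) (λ { (a , b , c) → r a b c * r a b c })
    r·extension≡r·r = ΣV3-cong n (λ { (a , b , c) → r a b c * extension a b c }) (λ { (a , b , c) → r a b c * r a b c }) pointwise
      where
      pointwise : ∀ a b c → a ℕ.+ b ℕ.+ c ≡ n → r a b c * extension a b c ≡ r a b c * r a b c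
      pointwise a b c eq with frame-or-pivot a c
      ... | inj₁ frame          = cong (r a b c *_) (extension-on-frame a b c eq frame)
      ... | inj₂ (1≤a , 2≤c) = begin
        r a b c * extension a b c   ≡⟨ cong (_* extension a b c) r≡0 ⟩
        0ℚ * extension a b c        ≡⟨ ℚP.*-zeroˡ (extension a b c) ⟩
        0ℚ                          ≡⟨ sym (ℚP.*-zeroˡ (r a b c)) ⟩
        0ℚ * r a b c                ≡⟨ cong (_* r a b c) (sym r≡0) ⟩
        r a b c * r a b c           ∎
        where
        r≡0 : r a b c ≡ 0ℚ
        r≡0 = proj₂ eliminate a b c eq 1≤a 2≤c
    extension∈span : InSpan n (Bs n) extension
    extension∈span = separable⇒inSpan-Bs n extension extension-separable
    r·extension≡0 : dot n r extension ≡ 0ℚ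
    r·extension≡0 = trans (dot-congʳ n r (proj₂ extension∈span)) (dot-lincombʳ n r (Bs n) (proj₁ extension∈span) r⊥Bs)
    r≈0 : r ≈[ n ] (λ _ _ _ → 0ℚ)
    r≈0 = All-V3⁻ n (λ { (a , b , c) → r a b c ≡ 0ℚ })
      (ΣList-squares≡0 (V3 n) (λ { (a , b , c) → r a b c }) (trans (sym r·extension≡r·r) r·extension≡0))
    v≈combination : v ≈[ n ] lincomb (Hs n) cH
    v≈combination a b c eq = trans (x-y≡0⇒x≡y _ _ (r≈0 a b c eq)) (combination≈lincomb a b c eq)

  inSpan-Hs⇒⊥Bs : ∀ n v → InSpan n (Hs n) v → All (λ w → dot n v w ≡ 0ℚ) (Bs n)
  inSpan-Hs⇒⊥Bs n v (c , v≈) = All.map (λ {w} w-separable → begin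
    dot n v w                     ≡⟨ dot-congˡ n w v≈ ⟩
    dot n (lincomb (Hs n) c) w    ≡⟨ dot-comm n (lincomb (Hs n) c) w ⟩
    dot n w (lincomb (Hs n) c)    ≡⟨ dot-lincombʳ n w (Hs n) c (separable⇒⊥Hs n w w-separable) ⟩
    0ℚ                            ∎) (XYZ-separable n (suc n))
    where open ≡-Reasoning

  inSpan-Bs⇔⊥Hs : ∀ n v → InSpan n (Bs n) v ⇔ All (λ h → dot n v h ≡ 0ℚ) (Hs n)
  inSpan-Bs⇔⊥Hs n v = mk⇔ (separable⇒⊥Hs n v ∘ inSpan-XYZ⇒separable n (suc n) v)
                          (separable⇒inSpan-Bs n v ∘ hexagons⇒separable n v ∘ Equivalence.to (⊥Hs⇔hexagons n v))

  inSpan-Hs⇔⊥Bs : ∀ n v → InSpan n (Hs n) v ⇔ All (λ w → dot n v w ≡ 0ℚ) (Bs n)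
  inSpan-Hs⇔⊥Bs n v = mk⇔ (inSpan-Hs⇒⊥Bs n v) (⊥Bs⇒inSpan-Hs n v)

open import Data.Nat using (_*_)
open import Data.Nat.Combinatorics using (_C_; nC1≡n; nCk+nC[k+1]≡[n+1]C[k+1])
open import Data.Rational using (ℚ; 0ℚ; _+_; -_; _-_) renaming (_*_ to _*ℚ_)
open CoordinateSpans using (XYZ; B's-independent; separable⇒inSpan-B's; inSpan-XYZ⇒separable; relVec≈0⇔standardRelation)
open HexagonVectors using (inSpan-Bs⇔⊥Hs; inSpan-Hs⇔⊥Bs)

length-XYZ : ∀ n k → length (XYZ n k) ≡ 3 * k
length-XYZ n k = begin
  length (XYZ n k)                           ≡⟨ ListP.length-++ (map (X n) (upTo k)) ⟩
  length (map (X n) (upTo k)) ℕ.+ length (map (Y n) (upTo k) ++ map (Z n) (upTo k))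
    ≡⟨ cong (length (map (X n) (upTo k)) ℕ.+_) (ListP.length-++ (map (Y n) (upTo k))) ⟩
  ℓ (X n) ℕ.+ (ℓ (Y n) ℕ.+ ℓ (Z n))          ≡⟨ cong₂ ℕ._+_ (k-entries (X n)) (cong₂ ℕ._+_ (k-entries (Y n)) (k-entries (Z n))) ⟩
  k ℕ.+ (k ℕ.+ k)                            ≡⟨ cong (λ t → k ℕ.+ (k ℕ.+ t)) (sym (ℕP.+-identityʳ k)) ⟩
  3 * k                                      ∎
  where
  open ≡-Reasoning
  ℓ : (ℕ → Vect) → ℕ
  ℓ f = length (map f (upTo k))
  k-entries : ∀ f → ℓ f ≡ k
  k-entries f = trans (ListP.length-map f (upTo k)) (ListP.length-upTo k)

[m+3]C2∸mC2≡3[m+1] : ∀ m → suc (suc (suc m)) C 2 ∸ m C 2 ≡ 3 * suc m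
[m+3]C2∸mC2≡3[m+1] m = begin
  suc (suc (suc m)) C 2 ∸ m C 2                        ≡⟨ cong (_∸ m C 2) pascal ⟩
  (suc (suc m) ℕ.+ suc m ℕ.+ m) ℕ.+ m C 2 ∸ m C 2      ≡⟨ ℕP.m+n∸n≡m _ (m C 2) ⟩
  suc (suc m) ℕ.+ suc m ℕ.+ m                          ≡⟨ ℕsolve 1 (λ m → (con 2 ⊕′ m) ⊕′ (con 1 ⊕′ m) ⊕′ m =′ con 3 ⊗′ (con 1 ⊕′ m)) refl m ⟩
  3 * suc m                                            ∎
  where
  open ≡-Reasoning
  open ℕSolver.+-*-Solver using (con) renaming (solve to ℕsolve; _:+_ to _⊕′_; _:*_ to _⊗′_; _:=_ to _=′_)
  pascal : suc (suc (suc m)) C 2 ≡ (suc (suc m) ℕ.+ suc m ℕ.+ m) ℕ.+ m C 2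
  pascal = begin
    suc (suc (suc m)) C 2                          ≡⟨ sym (nCk+nC[k+1]≡[n+1]C[k+1] (suc (suc m)) 1) ⟩
    suc (suc m) C 1 ℕ.+ suc (suc m) C 2            ≡⟨ cong₂ ℕ._+_ (nC1≡n (suc (suc m))) (sym (nCk+nC[k+1]≡[n+1]C[k+1] (suc m) 1)) ⟩
    suc (suc m) ℕ.+ (suc m C 1 ℕ.+ suc m C 2)      ≡⟨ cong (suc (suc m) ℕ.+_) (cong₂ ℕ._+_ (nC1≡n (suc m)) (sym (nCk+nC[k+1]≡[n+1]C[k+1] m 1))) ⟩
    suc (suc m) ℕ.+ (suc m ℕ.+ (m C 1 ℕ.+ m C 2))  ≡⟨ cong (λ t → suc (suc m) ℕ.+ (suc m ℕ.+ (t ℕ.+ m C 2))) (nC1≡n m) ⟩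
    suc (suc m) ℕ.+ (suc m ℕ.+ (m ℕ.+ m C 2))      ≡⟨ sym (trans (ℕP.+-assoc (suc (suc m) ℕ.+ suc m) m _) (ℕP.+-assoc (suc (suc m)) (suc m) _)) ⟩
    (suc (suc m) ℕ.+ suc m ℕ.+ m) ℕ.+ m C 2        ∎

proposition2p7 : (n : ℕ) → 1 ≤ n →
    -- ℝ𝓑_n is the orthogonal complement of ℝ𝓗_n
    ((v : Vect) → InSpan n (Bs n) v ⇔ All (λ h → dot n v h ≡ 0ℚ) (Hs n))
    -- ℝ𝓗_n is the orthogonal complement of ℝ𝓑_n
  × ((v : Vect) → InSpan n (Hs n) v ⇔ All (λ w → dot n v w ≡ 0ℚ) (Bs n))
    -- dim ℝ𝓑_n = C(n+2,2) - C(n-1,2) = 3n, realised by the basis 𝓑'_n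
  × (suc (suc n) C 2 ∸ (n ∸ 1) C 2 ≡ 3 * n)
  × (length (B's n) ≡ 3 * n)
  × LinIndep n (B's n)
  × ((v : Vect) → InSpan n (Bs n) v → InSpan n (B's n) v)
    -- all linear relations are generated by the three stated relations
  × ((x y z : ℕ → ℚ) →
       (relVec n x y z ≈[ n ] (λ _ _ _ → 0ℚ))
       ⇔ (∃ λ α → ∃ λ β → ∃ λ γ → (i : ℕ) → i ≤ n →
            (x i ≡ α + γ *ℚ ⟦ n ∸ i ⟧)
          × (y i ≡ (β - α) - γ *ℚ ⟦ i ⟧)
          × (z i ≡ - β - γ *ℚ ⟦ i ⟧)))
proposition2p7 n@(suc m) _ =
  inSpan-Bs⇔⊥Hs n ,
  inSpan-Hs⇔⊥Bs n ,
  [m+3]C2∸mC2≡3[m+1] m ,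
  length-XYZ n n ,
  B's-independent m ,
  (λ v → separable⇒inSpan-B's m v ∘ inSpan-XYZ⇒separable n (suc n) v) ,
  relVec≈0⇔standardRelation m
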